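{- Let $k_\mathcal{G}=k_\mathcal{H}=1$ and $d=n_\mathcal{G}+n_\mathcal{H}-1$. Suppose real numbers $c_{w,i}$, $1\le w\le\lceil d/2\rceil$, $0\le i\le\lceil d/2\rceil$, satisfy $c_{w,0}=-c_{w,1}$ for all $1\le w\le\lceil d/2\rceil$ and, for all $2\le k\le d$, $$(-1)^k\Big(\sum_{w=1}^{\lceil d/2\rceil}c_{w,1}^2+1\Big)=\sum_{i=\lceil k/2\rceil}^{\min\{k,\lceil d/2\rceil\}}\sum_{w=1}^{\lceil d/2\rceil}c_{w,i}^2\binom{i}{k-i}\binom{k}{i}+2\sum_{j=\lceil (k+1)/2\rceil}^{\min\{k,\lceil d/2\rceil\}}\sum_{i=k-j}^{j-1}\sum_{w=1}^{\lceil d/2\rceil}c_{w,i}c_{w,j}\binom{i}{k-j}\binom{k}{i}.$$ Then for any choice of $(g,h)\in V(\mathcal{G}\square\mathcal{H})$, the polynomials $s_{g^*h^*}=x_{g^*h^*}$ for all $(g^*,h^*)\in V(\mathcal{G}\square\mathcal{H})\setminus T_{gh}$ and $s_w=\sum_{i=0}^{\lceil d/2\rceil}c_{w,i}\rho^i_{gh}$ for $1\le w\le\lceil d/2\rceil$ form a $\lceil d/2\rceil$-SOS-certificate of $f_{\text{viz}}$, i.e. $f_{\text{viz}}\equiv\sum_{(g^*,h^*)\notin T_{gh}}s_{g^*h^*}^2+\sum_{w}s_w^2\pmod{I_{\text{viz}}}$; therefore Vizing's conjecture holds on the graph classes $\mathcal{G}$ and $\mathcal{H}$.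
   Context: Let $\mathbb{K}\subseteq\mathbb{R}$ be a field containing the numbers used. Let $n_\mathcal{G},n_\mathcal{H}$ be positive integers, $V(\mathcal{G})=\{g_1,\dots,g_{n_\mathcal{G}}\}$, $V(\mathcal{H})=\{h_1,\dots,h_{n_\mathcal{H}}\}$, $V(\mathcal{G}\square\mathcal{H})=V(\mathcal{G})\times V(\mathcal{H})$; $\mathcal{G}$ ($\mathcal{H}$) is the class of graphs on $V(\mathcal{G})$ ($V(\mathcal{H})$) with minimum dominating set $\{g_1\}$ ($\{h_1\}$). Introduce an edge variable $e_{gg'}=e_{g'g}$ for every unordered pair of distinct $g,g'\in V(\mathcal{G})$, an edge variable $e_{hh'}=e_{h'h}$ for every unordered pair of distinct $h,h'\in V(\mathcal{H})$, and a vertex variable $x_{gh}$ for every $(g,h)\in V(\mathcal{G}\square\mathcal{H})$; let $P$ be the polynomial ring over $\mathbb{K}$ in all these variables. For $k_\mathcal{G}=k_\mathcal{H}=1$ the Vizing ideal $I_{\text{viz}}\subseteq P$ is generated by: $e_{gg'}(e_{gg'}-1)$ for all distinct $g,g'\in V(\mathcal{G})$; $1-e_{gg_1}$ for all $g\ne g_1$; $e_{hh'}(e_{hh'}-1)$ for all distinct $h,h'\in V(\mathcal{H})$; $1-e_{hh_1}$ for all $h\neq h_1$; and, for all $(g,h)$, $x_{gh}(x_{gh}-1)$ and $(1-x_{gh})\prod_{g'\ne g}(1-e_{gg'}x_{g'h})\prod_{h'\neq h}(1-e_{hh'}x_{gh'})$. The Vizing polynomial is $f_{\text{viz}}=\big(\sum_{(g,h)}x_{gh}\big)-k_\mathcal{G}k_\mathcal{H}$.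 A polynomial $f$ is $\ell$-SOS modulo $I$ if $f-\sum_i s_i^2\in I$ for some polynomials $s_i$ of degree at most $\ell$ (an SOS-certificate of degree $\ell$); by prior work, $f_{\text{viz}}$ being $\ell$-SOS modulo $I_{\text{viz}}$ implies $\gamma(G\square H)\ge\gamma(G)\gamma(H)$ for all $G\in\mathcal{G}$, $H\in\mathcal{H}$. For $(g,h)$ let $T_{gh}=\{(g',h') : g'=g\text{ or }h'=h\}$ and, for $0\le i\le d$, $\rho^i_{gh}=\sum_{S\subseteq T_{gh},\,|S|=i}\prod_{(g',h')\in S}x_{g'h'}$ (so $\rho^0_{gh}=1$). -}

module Defs where

open import Level using (Level; _⊔_)
open import Algebra.Bundles using (CommutativeRing)
open import Data.Nat using (ℕ; zero; suc; _≤_; _∸_; _⊓_; ⌈_/2⌉; _≟_) renaming (_+_ to _+ℕ_; _*_ to _*ℕ_)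
open import Data.Nat.Combinatorics using (_C_)
open import Data.Fin using (Fin; zero; suc; toℕ; fromℕ<; punchIn)
open import Data.Fin.Properties using (<-cmp; punchInᵢ≢i)
open import Data.List using (List; []; _∷_; map; foldr; upTo; allFin; _++_; filter; length; concatMap)
open import Data.Product using (∃; _×_; _,_; proj₁; proj₂)
open import Relation.Binary.Definitions using (tri<; tri≈; tri>)
open import Relation.Binary.PropositionalEquality using (_≡_; sym)
open import Relation.Nullary using (¬_)
open import Data.Empty using (⊥-elim)

range : ℕ → ℕ → List ℕ
range a b = map (a +ℕ_) (upTo (suc b ∸ a))

-- all sublists of a list (= all subsets when the list has distinct entries)
sublists : ∀ {a} {A : Set a} → List A → List (List A)
sublists []       = [] ∷ []
sublists (x ∷ xs) = sublists xs ++ map (x ∷_) (sublists xs)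

-- The field K : a commutative ring which is a field of characteristic 0
-- (the stand-in for "a subfield of ℝ")

module FieldNotions {c ℓ : Level} (K : CommutativeRing c ℓ) where
  open CommutativeRing K using (Carrier; _≈_; _+_; _*_; -_; 0#; 1#)

  natK : ℕ → Carrier
  natK zero    = 0#
  natK (suc k) = 1# + natK k

  powK : Carrier → ℕ → Carrier
  powK a zero    = 1#
  powK a (suc k) = a * powK a k

  sumK : List ℕ → (ℕ → Carrier) → Carrier
  sumK xs f = foldr (λ i acc → f i + acc) 0# xs

  record IsCharZeroField : Set (c ⊔ ℓ) where
    field
      nontrivial : ¬ (1# ≈ 0#)
      inverse    : ∀ a → ¬ (a ≈ 0#) → ∃ λ b → a * b ≈ 1#
      charZero   : ∀ k → ¬ (natK (suc k) ≈ 0#)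

-- The Vizing setting for k_G = k_H = 1, n_G = suc m, n_H = suc n,
-- vertices g_1 = zero, h_1 = zero.

module Vizing {c ℓ : Level} (K : CommutativeRing c ℓ) (m n : ℕ) where
  open CommutativeRing K using (Carrier; _≈_; _+_; _*_; -_; 0#; 1#)
  open FieldNotions K public

  VG = Fin (suc m)
  VH = Fin (suc n)

  -- variables of P: one edge variable per unordered pair {j,i} (i < j) of
  -- distinct vertices of G (resp. H), one vertex variable per (g,h)
  data Var : Set where
    eG : (j : VG) → Fin (toℕ j) → Var
    eH : (j : VH) → Fin (toℕ j) → Var
    x  : VG → VH → Var

  edgeG : (g g' : VG) → ¬ (g ≡ g') → Var
  edgeG g g' ne with <-cmp g g'
  ... | tri< lt _ _ = eG g' (fromℕ< lt)
  ... | tri≈ _ eq _ = ⊥-elim (ne eq)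
  ... | tri> _ _ gt = eG g (fromℕ< gt)

  edgeH : (h h' : VH) → ¬ (h ≡ h') → Var
  edgeH h h' ne with <-cmp h h'
  ... | tri< lt _ _ = eH h' (fromℕ< lt)
  ... | tri≈ _ eq _ = ⊥-elim (ne eq)
  ... | tri> _ _ gt = eH h (fromℕ< gt)

  -- polynomial ring P = K[Var], presented as terms modulo the
  -- commutative K-algebra congruence
  infixl 6 _⊕_ _⊝_
  infixl 7 _⊗_
  data Poly : Set c where
    var  : Var → Poly
    con  : Carrier → Poly
    _⊕_  : Poly → Poly → Poly
    _⊗_  : Poly → Poly → Poly
    ⊖_   : Poly → Poly

  _⊝_ : Poly → Poly → Poly
  p ⊝ q = p ⊕ (⊖ q)

  infix 4 _≃_
  data _≃_ : Poly → Poly → Set (c ⊔ ℓ) where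
    ≃-refl   : ∀ {p} → p ≃ p
    ≃-sym    : ∀ {p q} → p ≃ q → q ≃ p
    ≃-trans  : ∀ {p q r} → p ≃ q → q ≃ r → p ≃ r
    ⊕-cong   : ∀ {p p' q q'} → p ≃ p' → q ≃ q' → p ⊕ q ≃ p' ⊕ q'
    ⊗-cong   : ∀ {p p' q q'} → p ≃ p' → q ≃ q' → p ⊗ q ≃ p' ⊗ q'
    ⊖-cong   : ∀ {p q} → p ≃ q → ⊖ p ≃ ⊖ q
    ⊕-assoc  : ∀ p q r → (p ⊕ q) ⊕ r ≃ p ⊕ (q ⊕ r)
    ⊕-comm   : ∀ p q → p ⊕ q ≃ q ⊕ p
    ⊕-idˡ    : ∀ p → con 0# ⊕ p ≃ p
    ⊖-invˡ   : ∀ p → (⊖ p) ⊕ p ≃ con 0#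
    ⊗-assoc  : ∀ p q r → (p ⊗ q) ⊗ r ≃ p ⊗ (q ⊗ r)
    ⊗-comm   : ∀ p q → p ⊗ q ≃ q ⊗ p
    ⊗-idˡ    : ∀ p → con 1# ⊗ p ≃ p
    ⊗-distribˡ : ∀ p q r → p ⊗ (q ⊕ r) ≃ (p ⊗ q) ⊕ (p ⊗ r)
    con-cong : ∀ {a b} → a ≈ b → con a ≃ con b
    con-+    : ∀ a b → con (a + b) ≃ con a ⊕ con b
    con-*    : ∀ a b → con (a * b) ≃ con a ⊗ con b

  data InIdeal {g} (Gen : Poly → Set g) : Poly → Set (c ⊔ ℓ ⊔ g) where
    gen  : ∀ {p} → Gen p → InIdeal Gen p
    zeroI : InIdeal Gen (con 0#)
    add  : ∀ {p q} → InIdeal Gen p → InIdeal Gen q → InIdeal Gen (p ⊕ q)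
    mul  : ∀ {p} (r : Poly) → InIdeal Gen p → InIdeal Gen (r ⊗ p)
    resp : ∀ {p q} → p ≃ q → InIdeal Gen p → InIdeal Gen q

  sumP : List Poly → Poly
  sumP = foldr _⊕_ (con 0#)

  prodP : List Poly → Poly
  prodP = foldr _⊗_ (con 1#)

  one : Poly
  one = con 1#

  X : VG → VH → Poly
  X g h = var (x g h)

  data VizGen : Poly → Set c where
    eG-bool : ∀ j i → VizGen (var (eG j i) ⊗ (var (eG j i) ⊝ one))
    eG-dom  : (i : Fin m) → VizGen (one ⊝ var (edgeG (suc i) zero (λ ())))
    eH-bool : ∀ j i → VizGen (var (eH j i) ⊗ (var (eH j i) ⊝ one))
    eH-dom  : (i : Fin n) → VizGen (one ⊝ var (edgeH (suc i) zero (λ ())))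
    x-bool  : ∀ g h → VizGen (X g h ⊗ (X g h ⊝ one))
    x-dom   : ∀ g h → VizGen
      ((one ⊝ X g h)
        ⊗ prodP (map (λ i → one ⊝ var (edgeG g (punchIn g i) (λ eq → punchInᵢ≢i g i (sym eq))) ⊗ X (punchIn g i) h) (allFin m))
        ⊗ prodP (map (λ i → one ⊝ var (edgeH h (punchIn h i) (λ eq → punchInᵢ≢i h i (sym eq))) ⊗ X g (punchIn h i)) (allFin n)))

  d : ℕ
  d = (suc m +ℕ suc n) ∸ 1

  D : ℕ
  D = ⌈ d /2⌉

  fviz : Poly
  fviz = sumP (concatMap (λ g → map (λ h → X g h) (allFin (suc n))) (allFin (suc m))) ⊝ con (natK (1 *ℕ 1))

  -- the vertices of T_{gh} = {(g',h') : g' = g or h' = h}, each listed once: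
  -- (g,h') for all h', and (g',h) for g' ≠ g
  T : VG → VH → List (VG × VH)
  T g h = map (λ h' → (g , h')) (allFin (suc n)) ++ map (λ i → (punchIn g i , h)) (allFin m)

  ρ : ℕ → VG → VH → Poly
  ρ i g h = sumP (map (λ S → prodP (map (λ v → X (proj₁ v) (proj₂ v)) S))
                      (filter (λ S → length S ≟ i) (sublists (T g h))))

  notT : VG → VH → List (VG × VH)
  notT g h = concatMap (λ i → map (λ j → (punchIn g i , punchIn h j)) (allFin n)) (allFin m)

  s : (ℕ → ℕ → Carrier) → VG → VH → ℕ → Poly
  s cc g h w = sumP (map (λ i → con (cc w i) ⊗ ρ i g h) (range 0 D))

  certificate : (ℕ → ℕ → Carrier) → VG → VH → Poly
  certificate cc g h =
    sumP (map (λ v → X (proj₁ v) (proj₂ v) ⊗ X (proj₁ v) (proj₂ v)) (notT g h))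
    ⊕ sumP (map (λ w → s cc g h w ⊗ s cc g h w) (range 1 D))

  sumW : (ℕ → Carrier) → Carrier
  sumW = sumK (range 1 D)

  record Hyp (cc : ℕ → ℕ → Carrier) : Set (c ⊔ ℓ) where
    field
      c0 : ∀ w → 1 ≤ w → w ≤ D → cc w 0 ≈ - cc w 1
      ck : ∀ k → 2 ≤ k → k ≤ d →
        powK (- 1#) k * (sumW (λ w → cc w 1 * cc w 1) + 1#)
          ≈ sumK (range ⌈ k /2⌉ (k ⊓ D))
                 (λ i → sumW (λ w → cc w i * cc w i * natK ((i C (k ∸ i)) *ℕ (k C i))))
            + natK 2 * sumK (range ⌈ suc k /2⌉ (k ⊓ D))
                 (λ j → sumK (range (k ∸ j) (j ∸ 1))
                   (λ i → sumW (λ w → cc w i * cc w j * natK ((i C (k ∸ j)) *ℕ (k C i)))))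

-- Modulo the ideal the vertex variables are 0/1-valued. Hence a polynomial in the variables x_v,
-- v ∈ T_gh, which is symmetric in them is determined by its values f t at points with t ones, and
-- if f vanishes for t ≥ 1 it is a multiple of Π_{v ∈ T_gh} (1 - x_v), which lies in the ideal since
-- the domination generator of (g, h) divides it. Once the squares x_v² (v ∉ T_gh) are cancelled
-- against f_viz, the difference f_viz - certificate is such a polynomial, with f t = t - 1 - Σ_w s_w(t)²
-- for s_w(t) = Σ_i c_{w,i} C(t,i). Writing C(t,i) C(t,j) = Σ_k C(t,k) C(k,i) C(i,k-j), the square
-- Σ_w s_w(t)² has coefficients in the basis C(t,k) that are exactly the right-hand sides of the
-- hypotheses, i.e. (-1)^k (Σ_w c_{w,1}² + 1) for k ≥ 2, while c_{w,0} = -c_{w,1} settles k ≤ 1;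
-- then f t = 0 for t ≥ 1 because Σ_k (-1)^k C(t,k) = 0.

module Submission where

open import Defs
open import Level using (Level)
open import Algebra.Bundles using (CommutativeRing; CommutativeSemiring; CommutativeMonoid)
open import Data.Nat using (ℕ)

module Sums {c ℓ} (S : CommutativeSemiring c ℓ) where

  open import Data.Nat as ℕ using (ℕ; zero; suc; z≤n; s≤s; _∸_)
  import Data.Nat.Properties as ℕ
  open import Data.List using (List; []; _∷_; map; foldr; applyUpTo)
  open import Data.Sum using (_⊎_; inj₁; inj₂)
  open import Relation.Binary.PropositionalEquality as ≡ using (_≡_)
  open import Relation.Nullary using (yes; no)

  open CommutativeSemiring S
  open import Algebra.Properties.CommutativeSemigroup +-commutativeSemigroup using (interchange)
  open import Algebra.Solver.CommutativeMonoid +-commutativeMonoid using (solve; _⊕_; _⊜_)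
  open import Relation.Binary.Reasoning.Setoid setoid

  -- FieldNotions.sumK, over an arbitrary commutative semiring.
  sumK : List ℕ → (ℕ → Carrier) → Carrier
  sumK xs f = foldr (λ i acc → f i + acc) 0# xs

  sum< : ℕ → (ℕ → Carrier) → Carrier
  sum< zero    f = 0#
  sum< (suc n) f = f 0 + sum< n (λ k → f (suc k))

  sum<-cong-< : ∀ n {f g} → (∀ k → k ℕ.< n → f k ≈ g k) → sum< n f ≈ sum< n g
  sum<-cong-< zero    f≈g = refl
  sum<-cong-< (suc n) f≈g = +-cong (f≈g 0 (s≤s z≤n)) (sum<-cong-< n (λ k k<n → f≈g (suc k) (s≤s k<n)))

  sum<-cong : ∀ n {f g} → (∀ k → f k ≈ g k) → sum< n f ≈ sum< n g
  sum<-cong n f≈g = sum<-cong-< n (λ k _ → f≈g k)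

  sum<-zero : ∀ n {f} → (∀ k → k ℕ.< n → f k ≈ 0#) → sum< n f ≈ 0#
  sum<-zero n f≈0 = trans (sum<-cong-< n f≈0) (zeros n)
    where
    zeros : ∀ n → sum< n (λ _ → 0#) ≈ 0#
    zeros zero    = refl
    zeros (suc n) = trans (+-identityˡ _) (zeros n)

  sum<-+ : ∀ n f g → sum< n (λ k → f k + g k) ≈ sum< n f + sum< n g
  sum<-+ zero    f g = sym (+-identityˡ 0#)
  sum<-+ (suc n) f g = trans (+-congˡ (sum<-+ n _ _)) (interchange (f 0) (g 0) _ _)

  sum<-*ˡ : ∀ n a f → a * sum< n f ≈ sum< n (λ k → a * f k)
  sum<-*ˡ zero    a f = zeroʳ a
  sum<-*ˡ (suc n) a f = trans (distribˡ a (f 0) _) (+-congˡ (sum<-*ˡ n a _))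

  sum<-last : ∀ n f → sum< (suc n) f ≈ sum< n f + f n
  sum<-last zero    f = +-comm (f 0) 0#
  sum<-last (suc n) f = trans (+-congˡ (sum<-last n _)) (sym (+-assoc (f 0) _ _))

  sum<-split : ∀ p q f → sum< (p ℕ.+ q) f ≈ sum< p f + sum< q (λ i → f (p ℕ.+ i))
  sum<-split zero    q f = sym (+-identityˡ _)
  sum<-split (suc p) q f = trans (+-congˡ (sum<-split p q _)) (sym (+-assoc (f 0) _ _))

  sum<-swap : ∀ n m (f : ℕ → ℕ → Carrier) →
    sum< n (λ i → sum< m (λ j → f i j)) ≈ sum< m (λ j → sum< n (λ i → f i j))
  sum<-swap zero    m f = sym (sum<-zero m (λ _ _ → refl))
  sum<-swap (suc n) m f =
    trans (+-congˡ (sum<-swap n m (λ i j → f (suc i) j))) (sym (sum<-+ m (f 0) (λ j → sum< n (λ i → f (suc i) j))))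

  sum<-product : ∀ n m f g → sum< n f * sum< m g ≈ sum< n (λ i → sum< m (λ j → f i * g j))
  sum<-product n m f g = begin
    sum< n f * sum< m g                       ≈⟨ *-comm _ _ ⟩
    sum< m g * sum< n f                       ≈⟨ sum<-*ˡ n (sum< m g) f ⟩
    sum< n (λ i → sum< m g * f i)             ≈⟨ sum<-cong n (λ i → *-comm (sum< m g) (f i)) ⟩
    sum< n (λ i → f i * sum< m g)             ≈⟨ sum<-cong n (λ i → sum<-*ˡ m (f i) g) ⟩
    sum< n (λ i → sum< m (λ j → f i * g j))   ∎

  sumK-cong : ∀ xs {f g} → (∀ k → f k ≈ g k) → sumK xs f ≈ sumK xs g
  sumK-cong []       f≈g = refl
  sumK-cong (x ∷ xs) f≈g = +-cong (f≈g x) (sumK-cong xs f≈g)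

  sumK-+ : ∀ xs f g → sumK xs (λ k → f k + g k) ≈ sumK xs f + sumK xs g
  sumK-+ []       f g = sym (+-identityˡ 0#)
  sumK-+ (x ∷ xs) f g = trans (+-congˡ (sumK-+ xs f g)) (interchange (f x) (g x) _ _)

  sumK-*ˡ : ∀ xs a f → a * sumK xs f ≈ sumK xs (λ k → a * f k)
  sumK-*ˡ []       a f = zeroʳ a
  sumK-*ˡ (x ∷ xs) a f = trans (distribˡ a (f x) _) (+-congˡ (sumK-*ˡ xs a f))

  sumK-sum< : ∀ xs n (f : ℕ → ℕ → Carrier) →
    sumK xs (λ w → sum< n (λ k → f w k)) ≈ sum< n (λ k → sumK xs (λ w → f w k))
  sumK-sum< []       n f = sym (sum<-zero n (λ _ _ → refl))
  sumK-sum< (x ∷ xs) n f =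
    trans (+-congˡ (sumK-sum< xs n f)) (sym (sum<-+ n (f x) (λ k → sumK xs (λ w → f w k))))

  sumK-swap : ∀ xs ys (f : ℕ → ℕ → Carrier) →
    sumK xs (λ i → sumK ys (λ j → f i j)) ≈ sumK ys (λ j → sumK xs (λ i → f i j))
  sumK-swap []       ys f = sym (zeros ys)
    where
    zeros : ∀ ys → sumK ys (λ _ → 0#) ≈ 0#
    zeros []       = refl
    zeros (y ∷ ys) = trans (+-identityˡ _) (zeros ys)
  sumK-swap (x ∷ xs) ys f =
    trans (+-congˡ (sumK-swap xs ys f)) (sym (sumK-+ ys (f x) (λ j → sumK xs (λ i → f i j))))

  sumK-range : ∀ a b f → sumK (range a b) f ≡ sum< (suc b ∸ a) (λ i → f (a ℕ.+ i))
  sumK-range a b f = go (suc b ∸ a) (λ i → i)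
    where
    go : ∀ n (h : ℕ → ℕ) → sumK (map (a ℕ.+_) (applyUpTo h n)) f ≡ sum< n (λ i → f (a ℕ.+ h i))
    go zero    h = ≡.refl
    go (suc n) h = ≡.cong (f (a ℕ.+ h 0) +_) (go n (λ i → h (suc i)))

  range-index-≤ : ∀ a b i → i ℕ.< suc b ∸ a → a ℕ.+ i ℕ.≤ b
  range-index-≤ a b i i<n with a ℕ.≤? suc b
  ... | yes a≤1+b =
    ℕ.≤-pred (≡.subst (ℕ._≤ suc b) (≡.cong suc (ℕ.+-comm i a)) (ℕ.m≤o∸n⇒m+n≤o (suc i) a≤1+b i<n))
  ... | no a≰1+b with () ← ≡.subst (i ℕ.<_) (ℕ.m≤n⇒m∸n≡0 (ℕ.<⇒≤ (ℕ.≰⇒> a≰1+b))) i<n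

  sumK-range-cong : ∀ a b {f g} → (∀ i → a ℕ.≤ i → i ℕ.≤ b → f i ≈ g i) →
    sumK (range a b) f ≈ sumK (range a b) g
  sumK-range-cong a b {f} {g} f≈g =
    ≡.subst₂ _≈_ (≡.sym (sumK-range a b f)) (≡.sym (sumK-range a b g))
      (sum<-cong-< (suc b ∸ a) (λ i i<n → f≈g (a ℕ.+ i) (ℕ.m≤m+n a i) (range-index-≤ a b i i<n)))

  sum<-as-range : ∀ N a b {g f} → b ℕ.< N →
    (∀ i → i ℕ.< N → i ℕ.< a ⊎ b ℕ.< i → g i ≈ 0#) →
    (∀ i → a ℕ.≤ i → i ℕ.≤ b → g i ≈ f i) →
    sum< N g ≈ sumK (range a b) f
  sum<-as-range N a b {g} {f} b<N outside inside = begin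
    sum< N g                                                  ≡⟨ ≡.cong (λ n → sum< n g) (ℕ.m+[n∸m]≡n b<N) ⟨
    sum< (suc b ℕ.+ (N ∸ suc b)) g                            ≈⟨ sum<-split (suc b) (N ∸ suc b) g ⟩
    sum< (suc b) g + sum< (N ∸ suc b) (λ i → g (suc b ℕ.+ i)) ≈⟨ +-cong prefix (sum<-zero (N ∸ suc b) suffix) ⟩
    sumK (range a b) f + 0#                                   ≈⟨ +-identityʳ _ ⟩
    sumK (range a b) f                                        ∎
    where
    suffix : ∀ i → i ℕ.< N ∸ suc b → g (suc b ℕ.+ i) ≈ 0#
    suffix i i<N-b = outside _ (≡.subst (suc b ℕ.+ i ℕ.<_) (ℕ.m+[n∸m]≡n b<N) (ℕ.+-monoʳ-< (suc b) i<N-b))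
                               (inj₂ (s≤s (ℕ.m≤m+n b i)))
    prefix : sum< (suc b) g ≈ sumK (range a b) f
    prefix with a ℕ.≤? suc b
    ... | yes a≤1+b = begin
      sum< (suc b) g                                    ≡⟨ ≡.cong (λ n → sum< n g) (ℕ.m+[n∸m]≡n a≤1+b) ⟨
      sum< (a ℕ.+ (suc b ∸ a)) g                        ≈⟨ sum<-split a (suc b ∸ a) g ⟩
      sum< a g + sum< (suc b ∸ a) (λ i → g (a ℕ.+ i))   ≈⟨ +-cong (sum<-zero a below) (sum<-cong-< (suc b ∸ a) within) ⟩
      0# + sum< (suc b ∸ a) (λ i → f (a ℕ.+ i))         ≈⟨ +-identityˡ _ ⟩
      sum< (suc b ∸ a) (λ i → f (a ℕ.+ i))              ≡⟨ sumK-range a b f ⟨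
      sumK (range a b) f                                ∎
      where
      below : ∀ i → i ℕ.< a → g i ≈ 0#
      below i i<a = outside i (ℕ.<-≤-trans i<a (ℕ.≤-trans a≤1+b b<N)) (inj₁ i<a)
      within : ∀ i → i ℕ.< suc b ∸ a → g (a ℕ.+ i) ≈ f (a ℕ.+ i)
      within i i<n = inside (a ℕ.+ i) (ℕ.m≤m+n a i) (range-index-≤ a b i i<n)
    ... | no a≰1+b = begin
      sum< (suc b) g
        ≈⟨ sum<-zero (suc b) (λ i i<1+b → outside i (ℕ.<-≤-trans i<1+b b<N) (inj₁ (ℕ.<-trans i<1+b b<a))) ⟩
      0#
        ≡⟨ ≡.cong (λ n → sum< n (λ i → f (a ℕ.+ i))) (ℕ.m≤n⇒m∸n≡0 (ℕ.<⇒≤ b<a)) ⟨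
      sum< (suc b ∸ a) (λ i → f (a ℕ.+ i))
        ≡⟨ sumK-range a b f ⟨
      sumK (range a b) f ∎
      where b<a = ℕ.≰⇒> a≰1+b

  sum<-square-split : ∀ N (F : ℕ → ℕ → Carrier) →
    sum< N (λ i → sum< N (λ j → F i j))
      ≈ sum< N (λ i → F i i) + sum< N (λ j → sum< j (λ i → F i j + F j i))
  sum<-square-split zero    F = sym (+-identityˡ 0#)
  sum<-square-split (suc N) F = begin
    sum< (suc N) (λ i → sum< (suc N) (λ j → F i j))
      ≈⟨ sum<-cong (suc N) (λ i → sum<-last N (F i)) ⟩
    sum< (suc N) (λ i → sum< N (λ j → F i j) + F i N)
      ≈⟨ sum<-+ (suc N) (λ i → sum< N (λ j → F i j)) (λ i → F i N) ⟩
    sum< (suc N) (λ i → sum< N (λ j → F i j)) + sum< (suc N) (λ i → F i N)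
      ≈⟨ +-cong (sum<-last N (λ i → sum< N (λ j → F i j))) (sum<-last N (λ i → F i N)) ⟩
    (sum< N (λ i → sum< N (λ j → F i j)) + sum< N (F N)) + (sum< N (λ i → F i N) + F N N)
      ≈⟨ +-congʳ (+-congʳ (sum<-square-split N F)) ⟩
    (diag N + off N + sum< N (F N)) + (sum< N (λ i → F i N) + F N N)
      ≈⟨ regroup _ _ _ _ _ ⟩
    (diag N + F N N) + (off N + (sum< N (λ i → F i N) + sum< N (F N)))
      ≈⟨ +-cong (sym (sum<-last N (λ i → F i i))) (+-congˡ (sym (sum<-+ N (λ i → F i N) (F N)))) ⟩
    diag (suc N) + (off N + sum< N (λ i → F i N + F N i))
      ≈⟨ +-congˡ (sym (sum<-last N (λ j → sum< j (λ i → F i j + F j i)))) ⟩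
    diag (suc N) + off (suc N) ∎
    where
    diag off : ℕ → Carrier
    diag n = sum< n (λ i → F i i)
    off n = sum< n (λ j → sum< j (λ i → F i j + F j i))
    regroup : ∀ d o x y z → (d + o + x) + (y + z) ≈ (d + z) + (o + (y + x))
    regroup = solve 5 (λ d o x y z → ((d ⊕ o) ⊕ x) ⊕ (y ⊕ z) ⊜ (d ⊕ z) ⊕ (o ⊕ (y ⊕ x))) refl

module ListFolds {a ℓ} (M : CommutativeMonoid a ℓ) where

  open import Data.Nat using (zero; suc)
  open import Data.Fin using (Fin; zero; suc; punchIn)
  open import Data.List using (List; []; _∷_; map; foldr; _++_; concatMap; tabulate; allFin)
  open import Data.List.Properties using (map-tabulate)
  open import Relation.Binary.PropositionalEquality as ≡ using (_≡_)
  open import Function using (id; _∘_)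

  open CommutativeMonoid M
  open import Algebra.Properties.CommutativeMonoid.Sum M using (sum; sum-remove)
  open import Algebra.Properties.CommutativeSemigroup commutativeSemigroup using (interchange)

  fold : List Carrier → Carrier
  fold = foldr _∙_ ε

  fold-++ : ∀ xs ys → fold (xs ++ ys) ≈ fold xs ∙ fold ys
  fold-++ []       ys = sym (identityˡ _)
  fold-++ (x ∷ xs) ys = trans (∙-congˡ (fold-++ xs ys)) (sym (assoc x _ _))

  fold-concatMap : ∀ {b} {B : Set b} (F : B → List Carrier) xs → fold (concatMap F xs) ≈ fold (map (fold ∘ F) xs)
  fold-concatMap F []       = refl
  fold-concatMap F (x ∷ xs) = trans (fold-++ (F x) _) (∙-congˡ (fold-concatMap F xs))

  fold-map-cong : ∀ {b} {B : Set b} {f g : B → Carrier} xs → (∀ x → f x ≈ g x) → fold (map f xs) ≈ fold (map g xs)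
  fold-map-cong []       f≈g = refl
  fold-map-cong (x ∷ xs) f≈g = ∙-cong (f≈g x) (fold-map-cong xs f≈g)

  fold-map-∙ : ∀ {b} {B : Set b} (f g : B → Carrier) xs →
    fold (map (λ x → f x ∙ g x) xs) ≈ fold (map f xs) ∙ fold (map g xs)
  fold-map-∙ f g []       = sym (identityˡ _)
  fold-map-∙ f g (x ∷ xs) = trans (∙-congˡ (fold-map-∙ f g xs)) (interchange (f x) (g x) _ _)

  fold-allFin-remove : ∀ {k} (f : Fin (suc k) → Carrier) p →
    fold (map f (allFin (suc k))) ≈ f p ∙ fold (map (f ∘ punchIn p) (allFin k))
  fold-allFin-remove f p = begin
    fold (map f (allFin _))                 ≡⟨ ≡.cong fold (map-tabulate id f) ⟩
    fold (tabulate f)                       ≡⟨ fold-tabulate f ⟩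
    sum f                                   ≈⟨ sum-remove f ⟩
    f p ∙ sum (f ∘ punchIn p)               ≡⟨ ≡.cong (f p ∙_) (fold-tabulate (f ∘ punchIn p)) ⟨
    f p ∙ fold (tabulate (f ∘ punchIn p))   ≡⟨ ≡.cong (λ xs → f p ∙ fold xs) (map-tabulate id (f ∘ punchIn p)) ⟨
    f p ∙ fold (map (f ∘ punchIn p) (allFin _)) ∎
    where
    open import Relation.Binary.Reasoning.Setoid setoid
    fold-tabulate : ∀ {k} (f : Fin k → Carrier) → fold (tabulate f) ≡ sum f
    fold-tabulate {zero}  f = ≡.refl
    fold-tabulate {suc k} f = ≡.cong (f zero ∙_) (fold-tabulate (f ∘ suc))

module Binomial where

  open import Data.Nat
  open import Data.Nat.Properties
  open import Data.Nat.Combinatorics using (_C_; nCk+nC[k+1]≡[n+1]C[k+1])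
  open import Data.Nat.Tactic.RingSolver using (solve-∀)
  open import Data.Sum using (inj₁; inj₂)
  open import Relation.Binary.PropositionalEquality
  open import Relation.Binary.Definitions using (tri<; tri≈; tri>)
  open Sums +-*-commutativeSemiring using (sum<; sum<-cong; sum<-+; sum<-zero; sum<-last)
  open ≡-Reasoning

  -- Binomial coefficients by Pascal's rule, so that they unfold by recursion.
  pascal : ℕ → ℕ → ℕ
  pascal n       zero    = 1
  pascal zero    (suc k) = 0
  pascal (suc n) (suc k) = pascal n k + pascal n (suc k)

  pascal≡C : ∀ n k → pascal n k ≡ n C k
  pascal≡C n       zero    = refl
  pascal≡C zero    (suc k) = refl
  pascal≡C (suc n) (suc k) =
    trans (cong₂ _+_ (pascal≡C n k) (pascal≡C n (suc k))) (nCk+nC[k+1]≡[n+1]C[k+1] n k)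

  pascal-> : ∀ n k → n < k → pascal n k ≡ 0
  pascal-> zero    (suc k) _         = refl
  pascal-> (suc n) (suc k) (s≤s n<k) = cong₂ _+_ (pascal-> n k n<k) (pascal-> n (suc k) (m<n⇒m<1+n n<k))

  pascal-diag : ∀ n → pascal n n ≡ 1
  pascal-diag zero    = refl
  pascal-diag (suc n) = cong₂ _+_ (pascal-diag n) (pascal-> n (suc n) ≤-refl)

  pascal-1 : ∀ n → pascal n 1 ≡ n
  pascal-1 zero    = refl
  pascal-1 (suc n) = cong suc (pascal-1 n)

  -- The number of pairs (A , B) with |A| = i, |B| = j and A ∪ B = {1..k},
  -- recursing on whether k lies in A only, in B only, or in both.
  unions : ℕ → ℕ → ℕ → ℕ
  unions zero    zero    zero    = 1
  unions zero    zero    (suc j) = 0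
  unions zero    (suc i) j       = 0
  unions (suc k) zero    zero    = 0
  unions (suc k) zero    (suc j) = unions k zero j
  unions (suc k) (suc i) zero    = unions k i zero
  unions (suc k) (suc i) (suc j) = unions k i (suc j) + unions k (suc i) j + unions k i j

  unions-sym : ∀ k i j → unions k i j ≡ unions k j i
  unions-sym zero    zero    zero    = refl
  unions-sym zero    zero    (suc j) = refl
  unions-sym zero    (suc i) zero    = refl
  unions-sym zero    (suc i) (suc j) = refl
  unions-sym (suc k) zero    zero    = refl
  unions-sym (suc k) zero    (suc j) = unions-sym k zero j
  unions-sym (suc k) (suc i) zero    = unions-sym k i zero
  unions-sym (suc k) (suc i) (suc j) = begin
    unions k i (suc j) + unions k (suc i) j + unions k i j
      ≡⟨ cong₂ (λ a b → a + b + unions k i j) (unions-sym k i (suc j)) (unions-sym k (suc i) j) ⟩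
    unions k (suc j) i + unions k j (suc i) + unions k i j
      ≡⟨ cong₂ _+_ (+-comm (unions k (suc j) i) _) (unions-sym k i j) ⟩
    unions k j (suc i) + unions k (suc j) i + unions k j i ∎

  unions-> : ∀ k i j → k < j → unions k i j ≡ 0
  unions-> zero    zero    (suc j) _         = refl
  unions-> zero    (suc i) (suc j) _         = refl
  unions-> (suc k) zero    (suc j) (s≤s k<j) = unions-> k zero j k<j
  unions-> (suc k) (suc i) (suc j) (s≤s k<j) =
    cong₂ _+_ (cong₂ _+_ (unions-> k i (suc j) (m<n⇒m<1+n k<j)) (unions-> k (suc i) j k<j)) (unions-> k i j k<j)

  -- Both sides vanish unless i ≡ k, when both are 1.
  pascal-square-step : ∀ k i → pascal k i * pascal i k ≡ pascal (suc k) (suc i) * pascal (suc i) (suc k)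
  pascal-square-step k i with <-cmp i k
  ... | tri< i<k _ _ = begin
    pascal k i * pascal i k                              ≡⟨ cong (pascal k i *_) (pascal-> i k i<k) ⟩
    pascal k i * 0                                       ≡⟨ *-zeroʳ (pascal k i) ⟩
    0                                                    ≡⟨ *-zeroʳ (pascal (suc k) (suc i)) ⟨
    pascal (suc k) (suc i) * 0                           ≡⟨ cong (pascal (suc k) (suc i) *_) (pascal-> (suc i) (suc k) (s≤s i<k)) ⟨
    pascal (suc k) (suc i) * pascal (suc i) (suc k)      ∎
  ... | tri≈ _ refl _ = cong₂ _*_ diag diag
    where diag = trans (pascal-diag i) (sym (pascal-diag (suc i)))
  ... | tri> _ _ k<i =
    trans (cong (_* pascal i k) (pascal-> k i k<i)) (sym (cong (_* pascal (suc i) (suc k)) (pascal-> (suc k) (suc i) (s≤s k<i))))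

  unions-closed : ∀ k i j → j ≤ k → unions k i j ≡ pascal k i * pascal i (k ∸ j)
  unions-closed zero    zero    zero    z≤n       = refl
  unions-closed zero    (suc i) zero    z≤n       = refl
  unions-closed (suc k) zero    zero    z≤n       = refl
  unions-closed (suc k) zero    (suc j) (s≤s j≤k) = unions-closed k zero j j≤k
  unions-closed (suc k) (suc i) zero    z≤n       = trans (unions-closed k i zero z≤n) (pascal-square-step k i)
  unions-closed (suc k) (suc i) (suc j) (s≤s j≤k) with m≤n⇒m<n∨m≡n j≤k
  ... | inj₂ refl = begin
    unions j i (suc j) + unions j (suc i) j + unions j i j
      ≡⟨ cong₂ _+_ (cong₂ _+_ (unions-> j i (suc j) ≤-refl) (unions-closed j (suc i) j ≤-refl))
                   (unions-closed j i j ≤-refl) ⟩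
    pascal j (suc i) * pascal (suc i) (j ∸ j) + pascal j i * pascal i (j ∸ j)
      ≡⟨ cong (λ r → pascal j (suc i) * pascal (suc i) r + pascal j i * pascal i r) (n∸n≡0 j) ⟩
    pascal j (suc i) * 1 + pascal j i * 1
      ≡⟨ regroup (pascal j i) (pascal j (suc i)) ⟩
    (pascal j i + pascal j (suc i)) * 1
      ≡⟨ cong (λ r → pascal (suc j) (suc i) * pascal (suc i) r) (sym (n∸n≡0 j)) ⟩
    pascal (suc j) (suc i) * pascal (suc i) (j ∸ j) ∎
    where
    regroup : ∀ a b → b * 1 + a * 1 ≡ (a + b) * 1
    regroup = solve-∀
  ... | inj₁ j<k = begin
    unions k i (suc j) + unions k (suc i) j + unions k i j
      ≡⟨ cong₂ _+_ (cong₂ _+_ (unions-closed k i (suc j) j<k) (unions-closed k (suc i) j j≤k)) (unions-closed k i j j≤k) ⟩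
    pascal k i * pascal i r + pascal k (suc i) * pascal (suc i) (k ∸ j) + pascal k i * pascal i (k ∸ j)
      ≡⟨ cong (λ s → pascal k i * pascal i r + pascal k (suc i) * pascal (suc i) s + pascal k i * pascal i s) k∸j≡1+r ⟩
    pascal k i * pascal i r + pascal k (suc i) * (pascal i r + pascal i (suc r)) + pascal k i * pascal i (suc r)
      ≡⟨ regroup (pascal k i) (pascal k (suc i)) (pascal i r) (pascal i (suc r)) ⟩
    pascal (suc k) (suc i) * pascal (suc i) (suc r)
      ≡⟨ cong (λ s → pascal (suc k) (suc i) * pascal (suc i) s) (sym k∸j≡1+r) ⟩
    pascal (suc k) (suc i) * pascal (suc i) (k ∸ j) ∎
    where
    r = k ∸ suc j
    k∸j≡1+r : k ∸ j ≡ suc r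
    k∸j≡1+r = +-∸-assoc 1 j<k
    regroup : ∀ a b p q → a * p + b * (p + q) + a * q ≡ (a + b) * (p + q)
    regroup = solve-∀

  pascal⁻ : ℕ → ℕ → ℕ
  pascal⁻ t zero    = 0
  pascal⁻ t (suc i) = pascal t i

  pascal-suc : ∀ t i → pascal (suc t) i ≡ pascal⁻ t i + pascal t i
  pascal-suc t zero    = refl
  pascal-suc t (suc i) = refl

  -- Counting pairs of an i-subset and a j-subset of a t-set by their union.
  pascal-product : ∀ t i j → pascal t i * pascal t j ≡ sum< (suc t) (λ k → pascal t k * unions k i j)

  shifted-pascal-product : ∀ t i j →
    sum< (suc t) (λ k → pascal t k * unions (suc k) i j)
      ≡ pascal⁻ t i * pascal t j + pascal t i * pascal⁻ t j + pascal⁻ t i * pascal⁻ t j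
  shifted-pascal-product t zero    zero    =
    sum<-zero (suc t) (λ k _ → *-zeroʳ (pascal t k))
  shifted-pascal-product t zero    (suc j) =
    trans (sym (pascal-product t 0 j)) (sym (+-identityʳ _))
  shifted-pascal-product t (suc i) zero    =
    trans (sym (pascal-product t i 0)) (pad (pascal t i) (pascal t (suc i)))
    where
    pad : ∀ a b → a * 1 ≡ a * 1 + b * 0 + a * 0
    pad = solve-∀
  shifted-pascal-product t (suc i) (suc j) = begin
    sum< (suc t) (λ k → C k * (unions k i (suc j) + unions k (suc i) j + unions k i j))
      ≡⟨ sum<-cong (suc t) (λ k → distrib₃ (C k) (unions k i (suc j)) (unions k (suc i) j) (unions k i j)) ⟩
    sum< (suc t) (λ k → C k * unions k i (suc j) + C k * unions k (suc i) j + C k * unions k i j)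
      ≡⟨ sum<-+ (suc t) (λ k → C k * unions k i (suc j) + C k * unions k (suc i) j) (λ k → C k * unions k i j) ⟩
    sum< (suc t) (λ k → C k * unions k i (suc j) + C k * unions k (suc i) j) + sum< (suc t) (λ k → C k * unions k i j)
      ≡⟨ cong (_+ sum< (suc t) (λ k → C k * unions k i j))
              (sum<-+ (suc t) (λ k → C k * unions k i (suc j)) (λ k → C k * unions k (suc i) j)) ⟩
    sum< (suc t) (λ k → C k * unions k i (suc j)) + sum< (suc t) (λ k → C k * unions k (suc i) j)
      + sum< (suc t) (λ k → C k * unions k i j)
      ≡⟨ cong₂ _+_ (cong₂ _+_ (pascal-product t i (suc j)) (pascal-product t (suc i) j)) (pascal-product t i j) ⟨
    C i * C (suc j) + C (suc i) * C j + C i * C j ∎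
    where
    C = pascal t
    distrib₃ : ∀ c x y z → c * (x + y + z) ≡ c * x + c * y + c * z
    distrib₃ = solve-∀

  pascal-product zero    zero    zero    = refl
  pascal-product zero    zero    (suc j) = refl
  pascal-product zero    (suc i) j       = refl
  pascal-product (suc t) i j = sym (begin
    1 * unions 0 i j + sum< (suc t) (λ k → (C k + C (suc k)) * unions (suc k) i j)
      ≡⟨ cong (1 * unions 0 i j +_) (trans (sum<-cong (suc t) (λ k → *-distribʳ-+ (unions (suc k) i j) (C k) (C (suc k))))
                                            (sum<-+ (suc t) (λ k → C k * unions (suc k) i j) (λ k → C (suc k) * unions (suc k) i j))) ⟩
    1 * unions 0 i j + (A + B)
      ≡⟨ exchange (1 * unions 0 i j) A B ⟩
    A + sum< (suc (suc t)) (λ k → C k * unions k i j)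
      ≡⟨ cong (A +_) (sum<-last (suc t) (λ k → C k * unions k i j)) ⟩
    A + (sum< (suc t) (λ k → C k * unions k i j) + C (suc t) * unions (suc t) i j)
      ≡⟨ cong (λ c → A + (sum< (suc t) (λ k → C k * unions k i j) + c * unions (suc t) i j)) (pascal-> t (suc t) ≤-refl) ⟩
    A + (sum< (suc t) (λ k → C k * unions k i j) + 0)
      ≡⟨ cong₂ (λ a b → a + (b + 0)) (shifted-pascal-product t i j) (sym (pascal-product t i j)) ⟩
    C⁻ i * C j + C i * C⁻ j + C⁻ i * C⁻ j + (C i * C j + 0)
      ≡⟨ expand (C⁻ i) (C i) (C⁻ j) (C j) ⟩
    (C⁻ i + C i) * (C⁻ j + C j)
      ≡⟨ cong₂ _*_ (pascal-suc t i) (pascal-suc t j) ⟨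
    pascal (suc t) i * pascal (suc t) j ∎)
    where
    C = pascal t
    C⁻ = pascal⁻ t
    A = sum< (suc t) (λ k → C k * unions (suc k) i j)
    B = sum< (suc t) (λ k → C (suc k) * unions (suc k) i j)
    exchange : ∀ u a b → u + (a + b) ≡ a + (u + b)
    exchange = solve-∀
    expand : ∀ a⁻ a b⁻ b → a⁻ * b + a * b⁻ + a⁻ * b⁻ + (a * b + 0) ≡ (a⁻ + a) * (b⁻ + b)
    expand = solve-∀

  unions-vanish : ∀ k i j → j ≤ k → i < k ∸ j → unions k i j ≡ 0
  unions-vanish k i j j≤k i<k∸j =
    trans (unions-closed k i j j≤k) (trans (cong (pascal k i *_) (pascal-> i (k ∸ j) i<k∸j)) (*-zeroʳ (pascal k i)))

  -- The weight C(i, k - j) C(k, i) of c_{w,i} c_{w,j} in the hypotheses of the theorem.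
  weight : ℕ → ℕ → ℕ → ℕ
  weight k i j = (i C (k ∸ j)) * (k C i)

  unions≡weight : ∀ k i j → j ≤ k → unions k i j ≡ weight k i j
  unions≡weight k i j j≤k =
    trans (unions-closed k i j j≤k) (trans (*-comm (pascal k i) _) (cong₂ _*_ (pascal≡C i (k ∸ j)) (pascal≡C k i)))

  double-≤ : ∀ j k → j ≤ ⌊ k /2⌋ → j + j ≤ k
  double-≤ j k j≤k/2 =
    subst (j + j ≤_) (⌊n/2⌋+⌈n/2⌉≡n k) (+-mono-≤ j≤k/2 (≤-trans j≤k/2 (⌊n/2⌋≤⌈n/2⌉ k)))

  double-< : ∀ i k → i < ⌈ k /2⌉ → i + i < k
  double-< i k i<k/2 = ≤-pred (subst (_≤ suc k) (cong suc (+-suc i i)) (double-≤ (suc i) (suc k) i<k/2))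

  <-⊓-bounded : ∀ k D i → k ⊓ D < i → i ≤ D → k < i
  <-⊓-bounded k D i k⊓D<i i≤D = ≰⇒> (λ i≤k → <⇒≱ k⊓D<i (⊓-glb i≤k i≤D))

module IntegerCoefficients {c ℓ} (R : CommutativeRing c ℓ) where

  open import Data.Nat as ℕ using (ℕ; zero; suc)
  import Data.Nat.Properties as ℕ
  open import Data.Integer as ℤ using (ℤ; +_; -[1+_]; _⊖_; sign; ∣_∣; _◃_)
  import Data.Integer.Properties as ℤ
  open import Data.Sign as Sign using (Sign)
  open import Data.Maybe using (Maybe; just; nothing)
  open import Relation.Nullary using (yes; no)
  open import Relation.Binary.PropositionalEquality as ≡ using (_≡_)
  open import Algebra.Solver.Ring.AlmostCommutativeRing using (fromCommutativeRing; _-Raw-AlmostCommutative⟶_)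

  open CommutativeRing R
  open import Algebra.Properties.Ring ring using (-1*x≈-x; -0#≈0#)
  open import Algebra.Properties.AbelianGroup +-abelianGroup using (⁻¹-involutive; ⁻¹-∙-comm)
  open import Algebra.Properties.CommutativeSemigroup *-commutativeSemigroup using (interchange)
  open import Algebra.Properties.CommutativeSemigroup +-commutativeSemigroup using (x∙yz≈y∙xz)
  open import Relation.Binary.Reasoning.Setoid setoid

  -- Unlike natK, this sends 1 to 1# definitionally, so that the solver's constant 1 is the 1# of goals.
  fromℕ : ℕ → Carrier
  fromℕ zero          = 0#
  fromℕ (suc zero)    = 1#
  fromℕ (suc (suc k)) = 1# + fromℕ (suc k)

  fromℕ-suc : ∀ k → fromℕ (suc k) ≈ 1# + fromℕ k
  fromℕ-suc zero    = sym (+-identityʳ 1#)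
  fromℕ-suc (suc k) = refl

  fromℕ-+ : ∀ a b → fromℕ (a ℕ.+ b) ≈ fromℕ a + fromℕ b
  fromℕ-+ zero    b = sym (+-identityˡ _)
  fromℕ-+ (suc a) b = begin
    fromℕ (suc (a ℕ.+ b))     ≈⟨ fromℕ-suc (a ℕ.+ b) ⟩
    1# + fromℕ (a ℕ.+ b)      ≈⟨ +-congˡ (fromℕ-+ a b) ⟩
    1# + (fromℕ a + fromℕ b)  ≈⟨ +-assoc 1# _ _ ⟨
    1# + fromℕ a + fromℕ b    ≈⟨ +-congʳ (fromℕ-suc a) ⟨
    fromℕ (suc a) + fromℕ b   ∎

  fromℕ-* : ∀ a b → fromℕ (a ℕ.* b) ≈ fromℕ a * fromℕ b
  fromℕ-* zero    b = sym (zeroˡ _)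
  fromℕ-* (suc a) b = begin
    fromℕ (b ℕ.+ a ℕ.* b)             ≈⟨ fromℕ-+ b (a ℕ.* b) ⟩
    fromℕ b + fromℕ (a ℕ.* b)         ≈⟨ +-cong (*-identityˡ _) (sym (fromℕ-* a b)) ⟨
    1# * fromℕ b + fromℕ a * fromℕ b  ≈⟨ distribʳ _ 1# (fromℕ a) ⟨
    (1# + fromℕ a) * fromℕ b          ≈⟨ *-congʳ (fromℕ-suc a) ⟨
    fromℕ (suc a) * fromℕ b           ∎

  fromℤ : ℤ → Carrier
  fromℤ (+ n)    = fromℕ n
  fromℤ -[1+ n ] = - fromℕ (suc n)

  fromℤ-⊖ : ∀ m n → fromℤ (m ⊖ n) ≈ fromℕ m - fromℕ n
  fromℤ-⊖ m       zero    = sym (trans (+-congˡ -0#≈0#) (+-identityʳ _))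
  fromℤ-⊖ zero    (suc n) = sym (+-identityˡ _)
  fromℤ-⊖ (suc m) (suc n) = begin
    fromℤ (suc m ⊖ suc n)               ≡⟨ ≡.cong fromℤ (ℤ.[1+m]⊖[1+n]≡m⊖n m n) ⟩
    fromℤ (m ⊖ n)                       ≈⟨ fromℤ-⊖ m n ⟩
    fromℕ m - fromℕ n                   ≈⟨ cancel 1# (fromℕ m) (fromℕ n) ⟩
    (1# + fromℕ m) + (- 1# - fromℕ n)   ≈⟨ +-congˡ (⁻¹-∙-comm 1# (fromℕ n)) ⟩
    (1# + fromℕ m) - (1# + fromℕ n)     ≈⟨ +-cong (fromℕ-suc m) (-‿cong (fromℕ-suc n)) ⟨
    fromℕ (suc m) - fromℕ (suc n)       ∎
    where
    cancel : ∀ u a b → a - b ≈ (u + a) + (- u - b)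
    cancel u a b = begin
      a - b                       ≈⟨ +-identityˡ _ ⟨
      0# + (a - b)                ≈⟨ +-congʳ (-‿inverseʳ u) ⟨
      (u - u) + (a - b)           ≈⟨ +-assoc u (- u) _ ⟩
      u + (- u + (a - b))         ≈⟨ +-congˡ (x∙yz≈y∙xz (- u) a (- b)) ⟩
      u + (a + (- u - b))         ≈⟨ +-assoc u a _ ⟨
      (u + a) + (- u - b)         ∎

  fromSign : Sign → Carrier
  fromSign Sign.+ = 1#
  fromSign Sign.- = - 1#

  fromSign-* : ∀ s t → fromSign (s Sign.* t) ≈ fromSign s * fromSign t
  fromSign-* Sign.+ t      = sym (*-identityˡ _)
  fromSign-* Sign.- Sign.+ = sym (*-identityʳ _)
  fromSign-* Sign.- Sign.- = sym (trans (-1*x≈-x (- 1#)) (⁻¹-involutive 1#))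

  fromℤ-◃ : ∀ s n → fromℤ (s ◃ n) ≈ fromSign s * fromℕ n
  fromℤ-◃ s      zero    = sym (zeroʳ _)
  fromℤ-◃ Sign.+ (suc n) = sym (*-identityˡ _)
  fromℤ-◃ Sign.- (suc n) = sym (-1*x≈-x _)

  fromℤ-sign-abs : ∀ i → fromℤ i ≈ fromSign (sign i) * fromℕ ∣ i ∣
  fromℤ-sign-abs (+ n)    = sym (*-identityˡ _)
  fromℤ-sign-abs -[1+ n ] = sym (-1*x≈-x _)

  fromℤ-* : ∀ i j → fromℤ (i ℤ.* j) ≈ fromℤ i * fromℤ j
  fromℤ-* i j = begin
    fromℤ (sign i Sign.* sign j ◃ ∣ i ∣ ℕ.* ∣ j ∣)
      ≈⟨ fromℤ-◃ (sign i Sign.* sign j) (∣ i ∣ ℕ.* ∣ j ∣) ⟩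
    fromSign (sign i Sign.* sign j) * fromℕ (∣ i ∣ ℕ.* ∣ j ∣)
      ≈⟨ *-cong (fromSign-* (sign i) (sign j)) (fromℕ-* ∣ i ∣ ∣ j ∣) ⟩
    (fromSign (sign i) * fromSign (sign j)) * (fromℕ ∣ i ∣ * fromℕ ∣ j ∣)
      ≈⟨ interchange _ _ _ _ ⟩
    (fromSign (sign i) * fromℕ ∣ i ∣) * (fromSign (sign j) * fromℕ ∣ j ∣)
      ≈⟨ *-cong (fromℤ-sign-abs i) (fromℤ-sign-abs j) ⟨
    fromℤ i * fromℤ j ∎

  fromℤ-+ : ∀ i j → fromℤ (i ℤ.+ j) ≈ fromℤ i + fromℤ j
  fromℤ-+ -[1+ m ] -[1+ n ] = begin
    - fromℕ (suc (suc (m ℕ.+ n)))       ≡⟨ ≡.cong (λ k → - fromℕ (suc k)) (ℕ.+-suc m n) ⟨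
    - fromℕ (suc m ℕ.+ suc n)           ≈⟨ -‿cong (fromℕ-+ (suc m) (suc n)) ⟩
    - (fromℕ (suc m) + fromℕ (suc n))   ≈⟨ ⁻¹-∙-comm _ _ ⟨
    - fromℕ (suc m) + - fromℕ (suc n)   ∎
  fromℤ-+ -[1+ m ] (+ n)    = trans (fromℤ-⊖ n (suc m)) (+-comm _ _)
  fromℤ-+ (+ m)    -[1+ n ] = fromℤ-⊖ m (suc n)
  fromℤ-+ (+ m)    (+ n)    = fromℕ-+ m n

  fromℤ-neg : ∀ i → fromℤ (ℤ.- i) ≈ - fromℤ i
  fromℤ-neg (+ zero)  = sym -0#≈0#
  fromℤ-neg (+ suc n) = refl
  fromℤ-neg -[1+ n ]  = sym (⁻¹-involutive _)

  fromℤ-homomorphism : ℤ.+-*-rawRing -Raw-AlmostCommutative⟶ fromCommutativeRing R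
  fromℤ-homomorphism = record
    { ⟦_⟧ = fromℤ ; +-homo = fromℤ-+ ; *-homo = fromℤ-* ; -‿homo = fromℤ-neg
    ; 0-homo = refl ; 1-homo = refl }

  fromℤ-≟ : ∀ a b → Maybe (fromℤ a ≈ fromℤ b)
  fromℤ-≟ a b with a ℤ.≟ b
  ... | yes ≡.refl = just refl
  ... | no _       = nothing

  open import Algebra.Solver.Ring ℤ.+-*-rawRing (fromCommutativeRing R) fromℤ-homomorphism fromℤ-≟ public

module PascalBasis {c ℓ} (K : CommutativeRing c ℓ) where

  open Binomial

  open import Data.Nat as ℕ using (ℕ; zero; suc; s≤s; _∸_; _⊓_; ⌈_/2⌉)
  import Data.Nat.Properties as ℕ
  open import Data.Sum using (_⊎_; inj₁; inj₂)
  open import Data.Empty using (⊥-elim)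
  open import Data.List using ([]; _∷_)
  open import Relation.Binary.PropositionalEquality as ≡ using (_≡_)

  open CommutativeRing K
  open FieldNotions K using (natK; powK)
  open Sums commutativeSemiring
  open import Algebra.Properties.Ring ring using (-0#≈0#; -1*x≈-x; -‿distribʳ-*)
  open import Algebra.Properties.AbelianGroup +-abelianGroup using (⁻¹-∙-comm)
  open import Algebra.Properties.CommutativeSemigroup +-commutativeSemigroup using () renaming (x∙yz≈y∙xz to x+[y+z]≈y+[x+z])
  open import Algebra.Properties.CommutativeSemigroup *-commutativeSemigroup using (interchange; x∙yz≈y∙xz)
  open import Relation.Binary.Reasoning.Setoid setoid
  private module ℕSums = Sums ℕ.+-*-commutativeSemiring

  sum<-neg : ∀ n f → sum< n (λ k → - f k) ≈ - sum< n f
  sum<-neg zero    f = sym -0#≈0#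
  sum<-neg (suc n) f = trans (+-congˡ (sum<-neg n _)) (⁻¹-∙-comm (f 0) _)

  sumK-neg : ∀ xs f → sumK xs (λ k → - f k) ≈ - sumK xs f
  sumK-neg []       f = sym -0#≈0#
  sumK-neg (x ∷ xs) f = trans (+-congˡ (sumK-neg xs f)) (⁻¹-∙-comm (f x) _)

  natK-+ : ∀ a b → natK (a ℕ.+ b) ≈ natK a + natK b
  natK-+ zero    b = sym (+-identityˡ _)
  natK-+ (suc a) b = trans (+-congˡ (natK-+ a b)) (sym (+-assoc 1# _ _))

  natK-* : ∀ a b → natK (a ℕ.* b) ≈ natK a * natK b
  natK-* zero    b = sym (zeroˡ _)
  natK-* (suc a) b = begin
    natK (b ℕ.+ a ℕ.* b)          ≈⟨ natK-+ b (a ℕ.* b) ⟩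
    natK b + natK (a ℕ.* b)       ≈⟨ +-cong (*-identityˡ _) (sym (natK-* a b)) ⟨
    1# * natK b + natK a * natK b ≈⟨ distribʳ _ 1# (natK a) ⟨
    (1# + natK a) * natK b        ∎

  natK-sum< : ∀ n f → natK (ℕSums.sum< n f) ≈ sum< n (λ k → natK (f k))
  natK-sum< zero    f = refl
  natK-sum< (suc n) f = trans (natK-+ (f 0) _) (+-congˡ (natK-sum< n _))

  natK-cong : ∀ {a b} → a ≡ b → natK a ≈ natK b
  natK-cong ≡.refl = refl

  -- The coefficient of C(t,k) in (Σ_i a i C(t,i))², by pascal-product.
  unionForm : ℕ → ℕ → (ℕ → Carrier) → Carrier
  unionForm N k a = sum< N (λ i → sum< N (λ j → a i * a j * natK (unions k i j)))

  square-in-pascal-basis : ∀ N t (a : ℕ → Carrier) →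
    sum< N (λ i → a i * natK (pascal t i)) * sum< N (λ i → a i * natK (pascal t i))
      ≈ sum< (suc t) (λ k → natK (pascal t k) * unionForm N k a)
  square-in-pascal-basis N t a = begin
    sum< N (λ i → a i * natK (pascal t i)) * sum< N (λ i → a i * natK (pascal t i))
      ≈⟨ sum<-product N N _ _ ⟩
    sum< N (λ i → sum< N (λ j → a i * natK (pascal t i) * (a j * natK (pascal t j))))
      ≈⟨ sum<-cong N (λ i → sum<-cong N (λ j → entry i j)) ⟩
    sum< N (λ i → sum< N (λ j → sum< (suc t) (λ k → G k i j)))
      ≈⟨ sum<-cong N (λ i → sum<-swap N (suc t) (G′ i)) ⟩
    sum< N (λ i → sum< (suc t) (λ k → sum< N (λ j → G k i j)))
      ≈⟨ sum<-swap N (suc t) (λ i k → sum< N (G k i)) ⟩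
    sum< (suc t) (λ k → sum< N (λ i → sum< N (λ j → G k i j)))
      ≈⟨ sum<-cong (suc t) (λ k → sum<-cong N (λ i → sum<-*ˡ N (natK (pascal t k)) (λ j → a i * a j * natK (unions k i j)))) ⟨
    sum< (suc t) (λ k → sum< N (λ i → natK (pascal t k) * sum< N (λ j → a i * a j * natK (unions k i j))))
      ≈⟨ sum<-cong (suc t) (λ k → sum<-*ˡ N (natK (pascal t k)) (λ i → sum< N (λ j → a i * a j * natK (unions k i j)))) ⟨
    sum< (suc t) (λ k → natK (pascal t k) * unionForm N k a) ∎
    where
    G : ℕ → ℕ → ℕ → Carrier
    G k i j = natK (pascal t k) * (a i * a j * natK (unions k i j))
    G′ : ℕ → ℕ → ℕ → Carrier
    G′ i j k = G k i j
    entry : ∀ i j → a i * natK (pascal t i) * (a j * natK (pascal t j)) ≈ sum< (suc t) (λ k → G k i j)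
    entry i j = begin
      a i * natK (pascal t i) * (a j * natK (pascal t j))
        ≈⟨ interchange (a i) _ (a j) _ ⟩
      a i * a j * (natK (pascal t i) * natK (pascal t j))
        ≈⟨ *-congˡ (trans (sym (natK-* (pascal t i) _)) (natK-cong (pascal-product t i j))) ⟩
      a i * a j * natK (ℕSums.sum< (suc t) (λ k → pascal t k ℕ.* unions k i j))
        ≈⟨ *-congˡ (natK-sum< (suc t) (λ k → pascal t k ℕ.* unions k i j)) ⟩
      a i * a j * sum< (suc t) (λ k → natK (pascal t k ℕ.* unions k i j))
        ≈⟨ sum<-*ˡ (suc t) (a i * a j) (λ k → natK (pascal t k ℕ.* unions k i j)) ⟩
      sum< (suc t) (λ k → a i * a j * natK (pascal t k ℕ.* unions k i j))
        ≈⟨ sum<-cong (suc t) (λ k → trans (*-congˡ (natK-* (pascal t k) (unions k i j)))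
                                          (x∙yz≈y∙xz (a i * a j) (natK (pascal t k)) (natK (unions k i j)))) ⟩
      sum< (suc t) (λ k → G k i j) ∎

  x+x≈2*x : ∀ x → x + x ≈ natK 2 * x
  x+x≈2*x x = sym (begin
    natK 2 * x                ≈⟨ distribʳ x 1# (1# + 0#) ⟩
    1# * x + (1# + 0#) * x    ≈⟨ +-cong (*-identityˡ x) (trans (*-congʳ (+-identityʳ 1#)) (*-identityˡ x)) ⟩
    x + x                     ∎)

  module _ (k : ℕ) (a : ℕ → Carrier) where

    private
      F : ℕ → ℕ → Carrier
      F i j = a i * a j * natK (unions k i j)

      F-zero : ∀ {i j} → unions k i j ≡ 0 → F i j ≈ 0#
      F-zero u≡0 = trans (*-congˡ (natK-cong u≡0)) (zeroʳ _)

    unionForm-diagonal : ∀ D →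
      sum< (suc D) (λ i → F i i) ≈ sumK (range ⌈ k /2⌉ (k ⊓ D)) (λ i → a i * a i * natK (weight k i i))
    unionForm-diagonal D = sum<-as-range (suc D) ⌈ k /2⌉ (k ⊓ D) (s≤s (ℕ.m⊓n≤n k D)) outside inside
      where
      outside : ∀ i → i ℕ.< suc D → i ℕ.< ⌈ k /2⌉ ⊎ k ⊓ D ℕ.< i → F i i ≈ 0#
      outside i _ (inj₁ i<k/2) =
        F-zero (unions-vanish k i i (ℕ.m+n≤o⇒m≤o i (ℕ.<⇒≤ 2i<k)) (ℕ.m+n≤o⇒m≤o∸n (suc i) 2i<k))
        where 2i<k = double-< i k i<k/2
      outside i i<1+D (inj₂ k⊓D<i) = F-zero (unions-> k i i (<-⊓-bounded k D i k⊓D<i (ℕ.≤-pred i<1+D)))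
      inside : ∀ i → ⌈ k /2⌉ ℕ.≤ i → i ℕ.≤ k ⊓ D → F i i ≈ a i * a i * natK (weight k i i)
      inside i _ i≤k⊓D = *-congˡ (natK-cong (unions≡weight k i i (ℕ.≤-trans i≤k⊓D (ℕ.m⊓n≤m k D))))

    unionForm-offDiagonal : ∀ D → sum< (suc D) (λ j → sum< j (λ i → F i j))
      ≈ sumK (range ⌈ suc k /2⌉ (k ⊓ D)) (λ j → sumK (range (k ∸ j) (j ∸ 1)) (λ i → a i * a j * natK (weight k i j)))
    unionForm-offDiagonal D = sum<-as-range (suc D) ⌈ suc k /2⌉ (k ⊓ D) (s≤s (ℕ.m⊓n≤n k D)) outside inside
      where
      outside : ∀ j → j ℕ.< suc D → j ℕ.< ⌈ suc k /2⌉ ⊎ k ⊓ D ℕ.< j → sum< j (λ i → F i j) ≈ 0#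
      outside j _ (inj₁ j<[k+1]/2) =
        sum<-zero j (λ i i<j → F-zero (unions-vanish k i j j≤k (ℕ.m+n≤o⇒m≤o∸n (suc i) (i+j≤k i i<j))))
        where
        2j≤k = double-≤ j k (ℕ.≤-pred j<[k+1]/2)
        j≤k = ℕ.m+n≤o⇒m≤o j 2j≤k
        i+j≤k = λ i i<j → ℕ.≤-trans (ℕ.+-monoˡ-≤ j i<j) 2j≤k
      outside j j<1+D (inj₂ k⊓D<j) =
        sum<-zero j (λ i _ → F-zero (unions-> k i j (<-⊓-bounded k D j k⊓D<j (ℕ.≤-pred j<1+D))))
      inside : ∀ j → ⌈ suc k /2⌉ ℕ.≤ j → j ℕ.≤ k ⊓ D →
        sum< j (λ i → F i j) ≈ sumK (range (k ∸ j) (j ∸ 1)) (λ i → a i * a j * natK (weight k i j))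
      inside (suc j) _ 1+j≤k⊓D = sum<-as-range (suc j) (k ∸ suc j) j ℕ.≤-refl outside′ inside′
        where
        1+j≤k = ℕ.≤-trans 1+j≤k⊓D (ℕ.m⊓n≤m k D)
        outside′ : ∀ i → i ℕ.< suc j → i ℕ.< k ∸ suc j ⊎ j ℕ.< i → F i (suc j) ≈ 0#
        outside′ i _     (inj₁ i<k-j) = F-zero (unions-vanish k i (suc j) 1+j≤k i<k-j)
        outside′ i i<1+j (inj₂ j<i)   = ⊥-elim (ℕ.<⇒≱ j<i (ℕ.≤-pred i<1+j))
        inside′ : ∀ i → k ∸ suc j ℕ.≤ i → i ℕ.≤ j → F i (suc j) ≈ a i * a (suc j) * natK (weight k i (suc j))
        inside′ i _ _ = *-congˡ (natK-cong (unions≡weight k i (suc j) 1+j≤k))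

  unionForm-split : ∀ D k (a : ℕ → Carrier) → unionForm (suc D) k a ≈
    sumK (range ⌈ k /2⌉ (k ⊓ D)) (λ i → a i * a i * natK (weight k i i))
    + natK 2 * sumK (range ⌈ suc k /2⌉ (k ⊓ D))
                 (λ j → sumK (range (k ∸ j) (j ∸ 1)) (λ i → a i * a j * natK (weight k i j)))
  unionForm-split D k a = begin
    unionForm (suc D) k a
      ≈⟨ sum<-square-split (suc D) F ⟩
    sum< (suc D) (λ i → F i i) + sum< (suc D) (λ j → sum< j (λ i → F i j + F j i))
      ≈⟨ +-congˡ (sum<-cong (suc D) (λ j → sum<-cong j (λ i → trans (+-congˡ (F-sym j i)) (x+x≈2*x (F i j))))) ⟩
    sum< (suc D) (λ i → F i i) + sum< (suc D) (λ j → sum< j (λ i → natK 2 * F i j))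
      ≈⟨ +-congˡ (trans (sum<-cong (suc D) (λ j → sym (sum<-*ˡ j (natK 2) (λ i → F i j))))
                        (sym (sum<-*ˡ (suc D) (natK 2) (λ j → sum< j (λ i → F i j))))) ⟩
    sum< (suc D) (λ i → F i i) + natK 2 * sum< (suc D) (λ j → sum< j (λ i → F i j))
      ≈⟨ +-cong (unionForm-diagonal k a D) (*-congˡ (unionForm-offDiagonal k a D)) ⟩
    _ ∎
    where
    F : ℕ → ℕ → Carrier
    F i j = a i * a j * natK (unions k i j)
    F-sym : ∀ j i → F j i ≈ F i j
    F-sym j i = *-cong (*-comm (a j) (a i)) (natK-cong (unions-sym k j i))

  alternating-pascal-sum : ∀ t → sum< (suc (suc t)) (λ k → natK (pascal (suc t) k) * powK (- 1#) k) ≈ 0#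
  alternating-pascal-sum t = begin
    natK 1 * 1# + sum< (suc t) (λ k → natK (pascal t k ℕ.+ pascal t (suc k)) * ±1 (suc k))
      ≈⟨ +-congˡ (trans (sum<-cong (suc t) (λ k → trans (*-congʳ (natK-+ (pascal t k) (pascal t (suc k))))
                                                        (distribʳ (±1 (suc k)) _ _)))
                        (sum<-+ (suc t) (λ k → natK (pascal t k) * ±1 (suc k)) (λ k → natK (pascal t (suc k)) * ±1 (suc k)))) ⟩
    natK 1 * 1# + (sum< (suc t) (λ k → natK (pascal t k) * ±1 (suc k)) + sum< (suc t) (λ k → natK (pascal t (suc k)) * ±1 (suc k)))
      ≈⟨ x+[y+z]≈y+[x+z] _ _ _ ⟩
    sum< (suc t) (λ k → natK (pascal t k) * ±1 (suc k)) + sum< (suc (suc t)) term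
      ≈⟨ +-cong (sum<-cong (suc t) (λ k → negate (natK (pascal t k)) (powK (- 1#) k))) (sum<-last (suc t) term) ⟩
    sum< (suc t) (λ k → - term k) + (X + natK (pascal t (suc t)) * ±1 (suc t))
      ≈⟨ +-cong (sum<-neg (suc t) term) (+-congˡ (trans (*-congʳ (natK-cong (pascal-> t (suc t) ℕ.≤-refl))) (zeroˡ _))) ⟩
    - X + (X + 0#)
      ≈⟨ trans (+-congˡ (+-identityʳ X)) (-‿inverseˡ X) ⟩
    0# ∎
    where
    ±1 : ℕ → Carrier
    ±1 = powK (- 1#)
    term : ℕ → Carrier
    term k = natK (pascal t k) * ±1 k
    X = sum< (suc t) term
    negate : ∀ x y → x * (- 1# * y) ≈ - (x * y)
    negate x y = trans (*-congˡ (-1*x≈-x y)) (sym (-‿distribʳ-* x y))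

module CertificateValues {c ℓ} (K : CommutativeRing c ℓ) (m n : ℕ)
  (cc : ℕ → ℕ → CommutativeRing.Carrier K) where

  open Binomial

  open import Data.Nat as ℕ using (zero; suc; z≤n; s≤s; _∸_; _⊓_; ⌈_/2⌉)
  import Data.Nat.Properties as ℕ
  open import Relation.Binary.PropositionalEquality as ≡ using (_≡_)

  open CommutativeRing K
  open Vizing K m n using (D; d; sumW; natK; powK; Hyp; module Hyp)
  open Sums commutativeSemiring
  open PascalBasis K
  open IntegerCoefficients K using (solve; _:=_; _:+_; _:*_; :-_)
  open import Algebra.Properties.Ring ring using (-1*x≈-x; -‿distribˡ-*)
  open import Relation.Binary.Reasoning.Setoid setoid

  -- The value of s_w at a point where exactly t of the variables x_v, v ∈ T_gh, equal 1.
  sValue : ℕ → ℕ → Carrier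
  sValue t w = sumK (range 0 D) (λ i → cc w i * natK (pascal t i))

  hypothesisSum : ℕ → Carrier
  hypothesisSum k =
    sumK (range ⌈ k /2⌉ (k ⊓ D)) (λ i → sumW (λ w → cc w i * cc w i * natK (weight k i i)))
    + natK 2 * sumK (range ⌈ suc k /2⌉ (k ⊓ D))
                 (λ j → sumK (range (k ∸ j) (j ∸ 1)) (λ i → sumW (λ w → cc w i * cc w j * natK (weight k i j))))

  sumW-unionForm : ∀ k → sumW (λ w → unionForm (suc D) k (cc w)) ≈ hypothesisSum k
  sumW-unionForm k = begin
    sumW (λ w → unionForm (suc D) k (cc w))
      ≈⟨ sumK-cong W (λ w → unionForm-split D k (cc w)) ⟩
    sumW (λ w → diagonal w + natK 2 * offDiagonal w)
      ≈⟨ sumK-+ W diagonal (λ w → natK 2 * offDiagonal w) ⟩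
    sumW diagonal + sumW (λ w → natK 2 * offDiagonal w)
      ≈⟨ +-cong (sumK-swap W R₁ (λ w i → cc w i * cc w i * natK (weight k i i)))
                (sym (sumK-*ˡ W (natK 2) offDiagonal)) ⟩
    _ + natK 2 * sumW offDiagonal
      ≈⟨ +-congˡ (*-congˡ (trans (sumK-swap W R₂ (λ w j → sumK (range (k ∸ j) (j ∸ 1)) (term w j)))
                                 (sumK-cong R₂ (λ j → sumK-swap W (range (k ∸ j) (j ∸ 1)) (λ w → term w j))))) ⟩
    hypothesisSum k ∎
    where
    W = range 1 D
    R₁ = range ⌈ k /2⌉ (k ⊓ D)
    R₂ = range ⌈ suc k /2⌉ (k ⊓ D)
    diagonal offDiagonal : ℕ → Carrier
    diagonal w = sumK R₁ (λ i → cc w i * cc w i * natK (weight k i i))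
    term : ℕ → ℕ → ℕ → Carrier
    term w j i = cc w i * cc w j * natK (weight k i j)
    offDiagonal w = sumK R₂ (λ j → sumK (range (k ∸ j) (j ∸ 1)) (term w j))

  S : Carrier
  S = sumW (λ w → cc w 1 * cc w 1)

  correction : ℕ → Carrier
  correction zero          = - 1#
  correction (suc zero)    = 1#
  correction (suc (suc _)) = 0#

  D≥1 : 1 ℕ.≤ D
  D≥1 = ℕ.⌈n/2⌉-mono (ℕ.≤-trans (s≤s z≤n) (ℕ.m≤n+m (suc n) m))

  *-one : ∀ x → x * natK 1 ≈ x
  *-one x = trans (*-congˡ (+-identityʳ 1#)) (*-identityʳ x)

  module _ (hyp : Hyp cc) where

    open Hyp hyp

    hypothesisSum-closed : ∀ k → k ℕ.≤ d → hypothesisSum k ≈ powK (- 1#) k * (S + 1#) + correction k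
    hypothesisSum-closed zero _ = begin
      (sumW (λ w → cc w 0 * cc w 0 * natK 1) + 0#) + natK 2 * 0#
        ≈⟨ trans (+-cong (+-identityʳ _) (zeroʳ _)) (+-identityʳ _) ⟩
      sumW (λ w → cc w 0 * cc w 0 * natK 1)
        ≈⟨ sumK-range-cong 1 D (λ w 1≤w w≤D →
             trans (*-one _) (trans (*-cong (c0 w 1≤w w≤D) (c0 w 1≤w w≤D)) (neg*neg (cc w 1) (cc w 1)))) ⟩
      S
        ≈⟨ x≈[x+y]-y S 1# ⟩
      (S + 1#) - 1#
        ≈⟨ +-congʳ (*-identityˡ _) ⟨
      1# * (S + 1#) - 1# ∎
      where
      neg*neg : ∀ x y → - x * - y ≈ x * y
      neg*neg = solve 2 (λ x y → :- x :* :- y := x :* y) refl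
      x≈[x+y]-y : ∀ x y → x ≈ (x + y) + - y
      x≈[x+y]-y = solve 2 (λ x y → x := (x :+ y) :+ :- y) refl
    hypothesisSum-closed (suc zero) _ =
      ≡.subst (λ b → sumK (range 1 b) f₁ + natK 2 * sumK (range 1 b) f₂ ≈ powK (- 1#) 1 * (S + 1#) + 1#)
              (≡.sym (ℕ.m≤n⇒m⊓n≡m D≥1)) (begin
      (S₁ + 0#) + natK 2 * ((M + 0#) + 0#)
        ≈⟨ +-cong (+-identityʳ _) (*-congˡ (trans (+-identityʳ _) (+-identityʳ _))) ⟩
      S₁ + natK 2 * M
        ≈⟨ +-cong (sumK-cong (range 1 D) (λ w → *-one _)) (*-congˡ mixed) ⟩
      S + natK 2 * - S
        ≈⟨ closed S ⟩
      (- 1# * 1#) * (S + 1#) + 1# ∎)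
      where
      f₁ f₂ : ℕ → Carrier
      f₁ i = sumW (λ w → cc w i * cc w i * natK (weight 1 i i))
      f₂ j = sumK (range (1 ∸ j) (j ∸ 1)) (λ i → sumW (λ w → cc w i * cc w j * natK (weight 1 i j)))
      S₁ = sumW (λ w → cc w 1 * cc w 1 * natK 1)
      M = sumW (λ w → cc w 0 * cc w 1 * natK 1)
      mixed : M ≈ - S
      mixed = trans (sumK-range-cong 1 D (λ w 1≤w w≤D →
                       trans (*-one _) (trans (*-congʳ (c0 w 1≤w w≤D)) (sym (-‿distribˡ-* (cc w 1) (cc w 1))))))
                    (sumK-neg (range 1 D) (λ w → cc w 1 * cc w 1))
      closed : ∀ s → s + natK 2 * - s ≈ (- 1# * 1#) * (s + 1#) + 1#
      closed s = begin
        s + natK 2 * - s              ≈⟨ +-congˡ (x+x≈2*x (- s)) ⟨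
        s + (- s + - s)               ≈⟨ solve 1 (λ s → s :+ (:- s :+ :- s) := :- s) refl s ⟩
        - s                           ≈⟨ solve 2 (λ s u → :- s := :- (s :+ u) :+ u) refl s 1# ⟩
        - (s + 1#) + 1#               ≈⟨ +-congʳ (-1*x≈-x _) ⟨
        - 1# * (s + 1#) + 1#          ≈⟨ +-congʳ (*-congʳ (*-identityʳ _)) ⟨
        (- 1# * 1#) * (s + 1#) + 1#   ∎
    hypothesisSum-closed (suc (suc k)) k≤d = trans (sym (ck (suc (suc k)) (s≤s (s≤s z≤n)) k≤d)) (sym (+-identityʳ _))

    -- In the basis t ↦ C(t,k) the coefficients are (-1)^k (S + 1) + correction k, and the
    -- alternating part drops out because Σ_k C(t,k) (-1)^k = 0 for t ≥ 1.
    sValue-squares : ∀ t → 1 ℕ.≤ t → t ℕ.≤ d → sumW (λ w → sValue t w * sValue t w) ≈ natK t - 1#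
    sValue-squares t@(suc t′) _ t≤d = begin
      sumW (λ w → sValue t w * sValue t w)
        ≈⟨ sumK-cong W (λ w → trans (reflexive (≡.cong₂ _*_ (sumK-range 0 D (s w)) (sumK-range 0 D (s w))))
                                    (square-in-pascal-basis (suc D) t (cc w))) ⟩
      sumW (λ w → sum< (suc t) (λ k → natK (pascal t k) * unionForm (suc D) k (cc w)))
        ≈⟨ sumK-sum< W (suc t) (λ w k → natK (pascal t k) * unionForm (suc D) k (cc w)) ⟩
      sum< (suc t) (λ k → sumW (λ w → natK (pascal t k) * unionForm (suc D) k (cc w)))
        ≈⟨ sum<-cong (suc t) (λ k → trans (sym (sumK-*ˡ W (natK (pascal t k)) (λ w → unionForm (suc D) k (cc w))))
                                          (*-congˡ (sumW-unionForm k))) ⟩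
      sum< (suc t) (λ k → natK (pascal t k) * hypothesisSum k)
        ≈⟨ sum<-cong-< (suc t) (λ k k<1+t → *-congˡ {natK (pascal t k)} (hypothesisSum-closed k (ℕ.≤-trans (ℕ.≤-pred k<1+t) t≤d))) ⟩
      sum< (suc t) (λ k → natK (pascal t k) * (powK (- 1#) k * (S + 1#) + correction k))
        ≈⟨ trans (sum<-cong (suc t) (λ k → expand (natK (pascal t k)) (powK (- 1#) k) (S + 1#) (correction k)))
                 (sum<-+ (suc t) (λ k → (S + 1#) * (natK (pascal t k) * powK (- 1#) k)) (λ k → natK (pascal t k) * correction k)) ⟩
      sum< (suc t) (λ k → (S + 1#) * (natK (pascal t k) * powK (- 1#) k)) + sum< (suc t) (λ k → natK (pascal t k) * correction k)
        ≈⟨ +-cong (trans (sym (sum<-*ˡ (suc t) (S + 1#) (λ k → natK (pascal t k) * powK (- 1#) k)))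
                         (trans (*-congˡ (alternating-pascal-sum t′)) (zeroʳ _)))
                  correction-sum ⟩
      0# + (natK t - 1#)
        ≈⟨ +-identityˡ _ ⟩
      natK t - 1# ∎
      where
      W = range 1 D
      s : ℕ → ℕ → Carrier
      s w i = cc w i * natK (pascal t i)
      expand : ∀ x p a e → x * (p * a + e) ≈ a * (x * p) + x * e
      expand = solve 4 (λ x p a e → x :* (p :* a :+ e) := a :* (x :* p) :+ x :* e) refl
      correction-sum : sum< (suc t) (λ k → natK (pascal t k) * correction k) ≈ natK t - 1#
      correction-sum = begin
        natK 1 * - 1# + (natK (pascal t 1) * 1# + sum< t′ (λ k → natK (pascal t (suc (suc k))) * 0#))
          ≈⟨ +-cong (trans (*-congʳ (+-identityʳ 1#)) (*-identityˡ _))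
                    (+-cong (trans (*-identityʳ _) (natK-cong (pascal-1 t))) (sum<-zero t′ (λ k _ → zeroʳ _))) ⟩
        - 1# + (natK t + 0#)
          ≈⟨ trans (+-congˡ (+-identityʳ _)) (+-comm _ _) ⟩
        natK t - 1# ∎

module PolynomialRing {c ℓ} (K : CommutativeRing c ℓ) (m n : ℕ) where

  open import Level using (_⊔_)
  open import Data.Product using (_,_)
  import Data.Integer as ℤ

  module K = CommutativeRing K
  open Vizing K m n

  ≃-commutativeRing : CommutativeRing c (c ⊔ ℓ)
  ≃-commutativeRing = record
    { Carrier = Poly ; _≈_ = _≃_ ; _+_ = _⊕_ ; _*_ = _⊗_ ; -_ = ⊖_ ; 0# = con K.0# ; 1# = con K.1#
    ; isCommutativeRing = record
      { isRing = record
        { +-isAbelianGroup = record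
          { isGroup = record
            { isMonoid = record
              { isSemigroup = record
                { isMagma = record
                  { isEquivalence = record { refl = ≃-refl ; sym = ≃-sym ; trans = ≃-trans }
                  ; ∙-cong = ⊕-cong }
                ; assoc = ⊕-assoc }
              ; identity = ⊕-idˡ , λ p → ≃-trans (⊕-comm p _) (⊕-idˡ p) }
            ; inverse = ⊖-invˡ , λ p → ≃-trans (⊕-comm p _) (⊖-invˡ p)
            ; ⁻¹-cong = ⊖-cong }
          ; comm = ⊕-comm }
        ; *-cong = ⊗-cong
        ; *-assoc = ⊗-assoc
        ; *-identity = ⊗-idˡ , λ p → ≃-trans (⊗-comm p _) (⊗-idˡ p)
        ; distrib = ⊗-distribˡ , λ p q r →
            ≃-trans (⊗-comm _ p) (≃-trans (⊗-distribˡ p q r) (⊕-cong (⊗-comm p q) (⊗-comm p r))) }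
      ; *-comm = ⊗-comm } }

  open CommutativeRing ≃-commutativeRing
    using (+-assoc; +-identityˡ; +-identityʳ; -‿inverseˡ; -‿inverseʳ; +-comm; *-assoc; *-identityˡ; *-identityʳ; distribˡ; distribʳ; *-comm)

  module Quotient {g} (Gen : Poly → Set g) where

    open IntegerCoefficients ≃-commutativeRing using (solve; _:=_; _:+_; _:-_; _:*_; :-_) renaming (con to κ)

    infix 4 _≈I_
    _≈I_ : Poly → Poly → Set (c ⊔ ℓ ⊔ g)
    p ≈I q = InIdeal Gen (p ⊝ q)

    ≃⇒≈I : ∀ {p q} → p ≃ q → p ≈I q
    ≃⇒≈I {q = q} p≃q = resp (≃-sym (≃-trans (⊕-cong p≃q ≃-refl) (-‿inverseʳ q))) zeroI

    ≈I-sym : ∀ {p q} → p ≈I q → q ≈I p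
    ≈I-sym {p} {q} p≈q = resp (solve 2 (λ p q → :- κ (ℤ.+ 1) :* (p :+ :- q) := q :+ :- p) ≃-refl p q) (mul (⊖ one) p≈q)

    ≈I-trans : ∀ {p q r} → p ≈I q → q ≈I r → p ≈I r
    ≈I-trans {p} {q} {r} p≈q q≈r =
      resp (solve 3 (λ p q r → (p :+ :- q) :+ (q :+ :- r) := p :+ :- r) ≃-refl p q r) (add p≈q q≈r)

    ⊕-cong-≈I : ∀ {p p′ q q′} → p ≈I p′ → q ≈I q′ → p ⊕ q ≈I p′ ⊕ q′
    ⊕-cong-≈I {p} {p′} {q} {q′} p≈p′ q≈q′ =
      resp (solve 4 (λ p p′ q q′ → (p :- p′) :+ (q :- q′) := (p :+ q) :- (p′ :+ q′)) ≃-refl p p′ q q′) (add p≈p′ q≈q′)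

    ⊗-cong-≈I : ∀ {p p′ q q′} → p ≈I p′ → q ≈I q′ → p ⊗ q ≈I p′ ⊗ q′
    ⊗-cong-≈I {p} {p′} {q} {q′} p≈p′ q≈q′ =
      resp (solve 4 (λ p p′ q q′ → q :* (p :- p′) :+ p′ :* (q :- q′) := p :* q :- p′ :* q′) ≃-refl p p′ q q′)
           (add (mul q p≈p′) (mul p′ q≈q′))

    ⊖-cong-≈I : ∀ {p p′} → p ≈I p′ → ⊖ p ≈I ⊖ p′
    ⊖-cong-≈I {p} {p′} p≈p′ =
      resp (solve 2 (λ p p′ → :- κ (ℤ.+ 1) :* (p :+ :- p′) := :- p :+ :- (:- p′)) ≃-refl p p′) (mul (⊖ one) p≈p′)

    quotientRing : CommutativeRing c (c ⊔ ℓ ⊔ g)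
    quotientRing = record
      { Carrier = Poly ; _≈_ = _≈I_ ; _+_ = _⊕_ ; _*_ = _⊗_ ; -_ = ⊖_ ; 0# = con K.0# ; 1# = one
      ; isCommutativeRing = record
        { isRing = record
          { +-isAbelianGroup = record
            { isGroup = record
              { isMonoid = record
                { isSemigroup = record
                  { isMagma = record
                    { isEquivalence = record { refl = ≃⇒≈I ≃-refl ; sym = ≈I-sym ; trans = ≈I-trans }
                    ; ∙-cong = ⊕-cong-≈I }
                  ; assoc = λ p q r → ≃⇒≈I (+-assoc p q r) }
                ; identity = (λ p → ≃⇒≈I (+-identityˡ p)) , (λ p → ≃⇒≈I (+-identityʳ p)) }
              ; inverse = (λ p → ≃⇒≈I (-‿inverseˡ p)) , (λ p → ≃⇒≈I (-‿inverseʳ p))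
              ; ⁻¹-cong = ⊖-cong-≈I }
            ; comm = λ p q → ≃⇒≈I (+-comm p q) }
          ; *-cong = ⊗-cong-≈I
          ; *-assoc = λ p q r → ≃⇒≈I (*-assoc p q r)
          ; *-identity = (λ p → ≃⇒≈I (*-identityˡ p)) , (λ p → ≃⇒≈I (*-identityʳ p))
          ; distrib = (λ p q r → ≃⇒≈I (distribˡ p q r)) , (λ p q r → ≃⇒≈I (distribʳ p q r)) }
        ; *-comm = λ p q → ≃⇒≈I (*-comm p q) } }

    ≈I0⇒∈ideal : ∀ {p} → p ≈I con K.0# → InIdeal Gen p
    ≈I0⇒∈ideal {p} = resp (solve 1 (λ p → p :+ :- κ (ℤ.+ 0) := p) ≃-refl p)

    gen⇒≈I0 : ∀ {p} → Gen p → p ≈I con K.0#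
    gen⇒≈I0 {p} gen-p = resp (solve 1 (λ p → p := p :+ :- κ (ℤ.+ 0)) ≃-refl p) (gen gen-p)

module Profiles {c ℓ} (K : CommutativeRing c ℓ) (m n : ℕ) where

  open Binomial

  open import Level using (_⊔_)
  open import Data.Nat as ℕ using (zero; suc; z≤n; s≤s; _≟_)
  import Data.Nat.Properties as ℕ
  open import Data.Bool using (true; false)
  open import Data.List using (List; []; _∷_; map; filter; length; _++_)
  open import Data.List.Properties using (filter-++)
  open import Data.Product using (Σ-syntax; _×_; _,_; proj₁; proj₂)
  open import Relation.Nullary using (does)
  open import Relation.Binary.PropositionalEquality as ≡ using (_≡_)
  import Data.Integer as ℤ

  module K = CommutativeRing K
  open Vizing K m n
  open PolynomialRing K m n using (module Quotient)
  open Quotient VizGen public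
  open CommutativeRing quotientRing
    using (refl; sym; trans; +-cong; *-cong; +-congˡ; +-congʳ; *-congˡ; *-congʳ; -‿cong;
           +-identityˡ; +-identityʳ; +-assoc; *-identityʳ; zeroˡ; zeroʳ; distribˡ; -‿inverseʳ; setoid)
  open IntegerCoefficients quotientRing using (solve; _:=_; _:+_; _:-_; _:*_; :-_) renaming (con to κ)
  open PascalBasis K using (natK-+)
  open import Relation.Binary.Reasoning.Setoid setoid

  Vertex = VG × VH

  x[_] : Vertex → Poly
  x[ v ] = X (proj₁ v) (proj₂ v)

  x²≈x : ∀ v → x[ v ] ⊗ x[ v ] ≈I x[ v ]
  x²≈x v = begin
    x[ v ] ⊗ x[ v ]                   ≈⟨ solve 1 (λ y → y :* y := y :* (y :+ :- κ (ℤ.+ 1)) :+ y) refl x[ v ] ⟩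
    x[ v ] ⊗ (x[ v ] ⊝ one) ⊕ x[ v ]  ≈⟨ +-congʳ (gen⇒≈I0 (x-bool (proj₁ v) (proj₂ v))) ⟩
    con K.0# ⊕ x[ v ]                 ≈⟨ +-identityˡ _ ⟩
    x[ v ]                            ∎

  x²-x≈0 : ∀ v → x[ v ] ⊗ x[ v ] ⊝ x[ v ] ≈I con K.0#
  x²-x≈0 v = trans (+-congʳ (x²≈x v)) (-‿inverseʳ (x[ v ]))

  con-cong-≈I : ∀ {a b} → a K.≈ b → con a ≈I con b
  con-cong-≈I a≈b = ≃⇒≈I (con-cong a≈b)

  -- Modulo the ideal, P is a multilinear polynomial in the x v (v ∈ L) whose value at a 0/1 point
  -- depends only on the number t of coordinates equal to 1, and is f t. The witness is the
  -- expansion P ≈ (1 - x v) P₀ + x v P₁ in the first variable.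
  HasProfile : List Vertex → Poly → (ℕ → K.Carrier) → Set (c ⊔ ℓ)
  HasProfile []      P f = P ≈I con (f 0)
  HasProfile (v ∷ L) P f = Σ[ P₀ ∈ Poly ] Σ[ P₁ ∈ Poly ]
    (P ≈I (one ⊝ x[ v ]) ⊗ P₀ ⊕ x[ v ] ⊗ P₁) × HasProfile L P₀ f × HasProfile L P₁ (λ t → f (suc t))

  HasProfile-cong : ∀ L {P f g} → (∀ t → f t K.≈ g t) → HasProfile L P f → HasProfile L P g
  HasProfile-cong []      f≈g P~f                        = trans P~f (con-cong-≈I (f≈g 0))
  HasProfile-cong (v ∷ L) f≈g (P₀ , P₁ , P≈ , P₀~ , P₁~) =
    P₀ , P₁ , P≈ , HasProfile-cong L f≈g P₀~ , HasProfile-cong L (λ t → f≈g (suc t)) P₁~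

  expand-in : ∀ v P → P ≈I (one ⊝ x[ v ]) ⊗ P ⊕ x[ v ] ⊗ P
  expand-in v P = solve 2 (λ y p → p := (κ (ℤ.+ 1) :- y) :* p :+ y :* p) refl x[ v ] P

  con-profile : ∀ L a → HasProfile L (con a) (λ _ → a)
  con-profile []      a = refl
  con-profile (v ∷ L) a = con a , con a , expand-in v (con a) , con-profile L a , con-profile L a

  ⊕-profile : ∀ L {P Q f g} → HasProfile L P f → HasProfile L Q g → HasProfile L (P ⊕ Q) (λ t → f t K.+ g t)
  ⊕-profile []      P~ Q~ = trans (+-cong P~ Q~) (sym (≃⇒≈I (con-+ _ _)))
  ⊕-profile (v ∷ L) (P₀ , P₁ , P≈ , P₀~ , P₁~) (Q₀ , Q₁ , Q≈ , Q₀~ , Q₁~) =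
    P₀ ⊕ Q₀ , P₁ ⊕ Q₁ , trans (+-cong P≈ Q≈) (regroup x[ v ] P₀ P₁ Q₀ Q₁) ,
    ⊕-profile L P₀~ Q₀~ , ⊕-profile L P₁~ Q₁~
    where
    regroup : ∀ y p₀ p₁ q₀ q₁ → ((one ⊝ y) ⊗ p₀ ⊕ y ⊗ p₁) ⊕ ((one ⊝ y) ⊗ q₀ ⊕ y ⊗ q₁)
      ≈I (one ⊝ y) ⊗ (p₀ ⊕ q₀) ⊕ y ⊗ (p₁ ⊕ q₁)
    regroup = solve 5 (λ y p₀ p₁ q₀ q₁ → ((κ (ℤ.+ 1) :- y) :* p₀ :+ y :* p₁) :+ ((κ (ℤ.+ 1) :- y) :* q₀ :+ y :* q₁)
                                          := (κ (ℤ.+ 1) :- y) :* (p₀ :+ q₀) :+ y :* (p₁ :+ q₁)) refl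

  ⊖-profile : ∀ L {P f} → HasProfile L P f → HasProfile L (⊖ P) (λ t → K.- f t)
  ⊖-profile []      P~ = trans (-‿cong P~) (sym con-neg)
    where
    con-neg : ∀ {a} → con (K.- a) ≈I ⊖ con a
    con-neg {a} = begin
      con (K.- a)                     ≈⟨ solve 2 (λ p q → p := (p :+ q) :+ :- q) refl (con (K.- a)) (con a) ⟩
      (con (K.- a) ⊕ con a) ⊕ ⊖ con a  ≈⟨ +-congʳ (sym (≃⇒≈I (con-+ (K.- a) a))) ⟩
      con (K.- a K.+ a) ⊕ ⊖ con a      ≈⟨ +-congʳ (con-cong-≈I (K.-‿inverseˡ a)) ⟩
      con K.0# ⊕ ⊖ con a               ≈⟨ +-identityˡ _ ⟩
      ⊖ con a                          ∎
  ⊖-profile (v ∷ L) (P₀ , P₁ , P≈ , P₀~ , P₁~) =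
    ⊖ P₀ , ⊖ P₁ , trans (-‿cong P≈) (negate x[ v ] P₀ P₁) , ⊖-profile L P₀~ , ⊖-profile L P₁~
    where
    negate : ∀ y a b → ⊖ ((one ⊝ y) ⊗ a ⊕ y ⊗ b) ≈I (one ⊝ y) ⊗ (⊖ a) ⊕ y ⊗ (⊖ b)
    negate = solve 3 (λ y a b → :- ((κ (ℤ.+ 1) :- y) :* a :+ y :* b) := (κ (ℤ.+ 1) :- y) :* (:- a) :+ y :* (:- b)) refl

  -- Multiplying two expansions leaves the cross term (x² - x)(P₀ - P₁)(Q₀ - Q₁), which lies in the ideal.
  ⊗-profile : ∀ L {P Q f g} → HasProfile L P f → HasProfile L Q g → HasProfile L (P ⊗ Q) (λ t → f t K.* g t)
  ⊗-profile []      P~ Q~ = trans (*-cong P~ Q~) (sym (≃⇒≈I (con-* _ _)))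
  ⊗-profile (v ∷ L) (P₀ , P₁ , P≈ , P₀~ , P₁~) (Q₀ , Q₁ , Q≈ , Q₀~ , Q₁~) =
    P₀ ⊗ Q₀ , P₁ ⊗ Q₁ , PQ≈ , ⊗-profile L P₀~ Q₀~ , ⊗-profile L P₁~ Q₁~
    where
    y = x[ v ]
    expand : ∀ y p₀ p₁ q₀ q₁ → ((one ⊝ y) ⊗ p₀ ⊕ y ⊗ p₁) ⊗ ((one ⊝ y) ⊗ q₀ ⊕ y ⊗ q₁)
      ≈I ((one ⊝ y) ⊗ (p₀ ⊗ q₀) ⊕ y ⊗ (p₁ ⊗ q₁)) ⊕ (y ⊗ y ⊝ y) ⊗ (p₀ ⊗ q₀ ⊝ p₀ ⊗ q₁ ⊝ p₁ ⊗ q₀ ⊕ p₁ ⊗ q₁)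
    expand = solve 5 (λ y p₀ p₁ q₀ q₁ → ((κ (ℤ.+ 1) :- y) :* p₀ :+ y :* p₁) :* ((κ (ℤ.+ 1) :- y) :* q₀ :+ y :* q₁)
                 := ((κ (ℤ.+ 1) :- y) :* (p₀ :* q₀) :+ y :* (p₁ :* q₁))
                    :+ (y :* y :+ :- y) :* (p₀ :* q₀ :+ :- (p₀ :* q₁) :+ :- (p₁ :* q₀) :+ p₁ :* q₁)) refl
    PQ≈ : _ ≈I (one ⊝ y) ⊗ (P₀ ⊗ Q₀) ⊕ y ⊗ (P₁ ⊗ Q₁)
    PQ≈ = trans (*-cong P≈ Q≈) (trans (expand y P₀ P₁ Q₀ Q₁)
                (trans (+-congˡ (trans (*-congʳ (x²-x≈0 v)) (zeroˡ _))) (+-identityʳ _)))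

  sumP-profile : ∀ L (xs : List ℕ) (F : ℕ → Poly) (f : ℕ → ℕ → K.Carrier) →
    (∀ a → HasProfile L (F a) (f a)) → HasProfile L (sumP (map F xs)) (λ t → sumK xs (λ a → f a t))
  sumP-profile L []       F f F~f = con-profile L K.0#
  sumP-profile L (a ∷ xs) F f F~f = ⊕-profile L (F~f a) (sumP-profile L xs F f F~f)

  sumX-profile : ∀ L → HasProfile L (sumP (map x[_] L)) natK
  sumX-profile []      = refl
  sumX-profile (v ∷ L) =
    sumP (map x[_] L) , one ⊕ sumP (map x[_] L) , split x[ v ] (sumP (map x[_] L)) ,
    sumX-profile L , ⊕-profile L (con-profile L K.1#) (sumX-profile L)
    where
    split : ∀ y s → y ⊕ s ≈I (one ⊝ y) ⊗ s ⊕ y ⊗ (one ⊕ s)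
    split = solve 2 (λ y s → y :+ s := (κ (ℤ.+ 1) :- y) :* s :+ y :* (κ (ℤ.+ 1) :+ s)) refl

  monomialSum : List (List Vertex) → Poly
  monomialSum Ss = sumP (map (λ S → prodP (map x[_] S)) Ss)

  -- e_i(x v : v ∈ L); the paper's ρ i g h is elementary (T g h) i.
  elementary : List Vertex → ℕ → Poly
  elementary L i = monomialSum (filter (λ S → length S ≟ i) (sublists L))

  monomialSum-++ : ∀ Ss Ts → monomialSum (Ss ++ Ts) ≈I monomialSum Ss ⊕ monomialSum Ts
  monomialSum-++ []       Ts = sym (+-identityˡ _)
  monomialSum-++ (S ∷ Ss) Ts = trans (+-congˡ (monomialSum-++ Ss Ts)) (sym (+-assoc _ _ _))

  monomialSum-∷ : ∀ v Ss → monomialSum (map (v ∷_) Ss) ≈I x[ v ] ⊗ monomialSum Ss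
  monomialSum-∷ v []       = sym (zeroʳ _)
  monomialSum-∷ v (S ∷ Ss) = trans (+-congˡ (monomialSum-∷ v Ss)) (sym (distribˡ _ _ _))

  filter-∷-zero : ∀ v (Ss : List (List Vertex)) → filter (λ S → length S ≟ 0) (map (v ∷_) Ss) ≡ []
  filter-∷-zero v []       = ≡.refl
  filter-∷-zero v (S ∷ Ss) = filter-∷-zero v Ss

  filter-∷-suc : ∀ v i (Ss : List (List Vertex)) →
    filter (λ S → length S ≟ suc i) (map (v ∷_) Ss) ≡ map (v ∷_) (filter (λ S → length S ≟ i) Ss)
  filter-∷-suc v i []       = ≡.refl
  filter-∷-suc v i (S ∷ Ss) with does (length S ≟ i)
  ... | true  = ≡.cong ((v ∷ S) ∷_) (filter-∷-suc v i Ss)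
  ... | false = filter-∷-suc v i Ss

  elementary-∷-zero : ∀ v L → elementary (v ∷ L) 0 ≈I elementary L 0
  elementary-∷-zero v L = begin
    monomialSum (filter P (sublists L ++ map (v ∷_) (sublists L)))
      ≡⟨ ≡.cong monomialSum (filter-++ P (sublists L) (map (v ∷_) (sublists L))) ⟩
    monomialSum (filter P (sublists L) ++ filter P (map (v ∷_) (sublists L)))
      ≈⟨ monomialSum-++ (filter P (sublists L)) _ ⟩
    elementary L 0 ⊕ monomialSum (filter P (map (v ∷_) (sublists L)))
      ≡⟨ ≡.cong (λ Ss → elementary L 0 ⊕ monomialSum Ss) (filter-∷-zero v (sublists L)) ⟩
    elementary L 0 ⊕ con K.0#
      ≈⟨ +-identityʳ _ ⟩
    elementary L 0 ∎
    where P = λ (S : List Vertex) → length S ≟ 0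

  elementary-∷-suc : ∀ v L i → elementary (v ∷ L) (suc i) ≈I elementary L (suc i) ⊕ x[ v ] ⊗ elementary L i
  elementary-∷-suc v L i = begin
    monomialSum (filter P (sublists L ++ map (v ∷_) (sublists L)))
      ≡⟨ ≡.cong monomialSum (filter-++ P (sublists L) (map (v ∷_) (sublists L))) ⟩
    monomialSum (filter P (sublists L) ++ filter P (map (v ∷_) (sublists L)))
      ≈⟨ monomialSum-++ (filter P (sublists L)) _ ⟩
    elementary L (suc i) ⊕ monomialSum (filter P (map (v ∷_) (sublists L)))
      ≡⟨ ≡.cong (λ Ss → elementary L (suc i) ⊕ monomialSum Ss) (filter-∷-suc v i (sublists L)) ⟩
    elementary L (suc i) ⊕ monomialSum (map (v ∷_) (filter (λ S → length S ≟ i) (sublists L)))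
      ≈⟨ +-congˡ (monomialSum-∷ v (filter (λ S → length S ≟ i) (sublists L))) ⟩
    elementary L (suc i) ⊕ x[ v ] ⊗ elementary L i ∎
    where P = λ (S : List Vertex) → length S ≟ suc i

  elementary-profile : ∀ L i → HasProfile L (elementary L i) (λ t → natK (pascal t i))
  elementary-profile []      zero    = sym (≃⇒≈I (con-+ K.1# K.0#))
  elementary-profile []      (suc i) = refl
  elementary-profile (v ∷ L) zero    =
    elementary L 0 , elementary L 0 , trans (elementary-∷-zero v L) (expand-in v (elementary L 0)) ,
    elementary-profile L 0 , elementary-profile L 0
  elementary-profile (v ∷ L) (suc i) =
    elementary L (suc i) , elementary L (suc i) ⊕ elementary L i ,
    trans (elementary-∷-suc v L i) (split x[ v ] _ _) ,
    elementary-profile L (suc i) ,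
    HasProfile-cong L (λ t → K.trans (K.+-comm _ _) (K.sym (natK-+ (pascal t i) (pascal t (suc i)))))
      (⊕-profile L (elementary-profile L (suc i)) (elementary-profile L i))
    where
    split : ∀ y a b → a ⊕ y ⊗ b ≈I (one ⊝ y) ⊗ a ⊕ y ⊗ (a ⊕ b)
    split = solve 3 (λ y a b → a :+ y :* b := (κ (ℤ.+ 1) :- y) :* a :+ y :* (a :+ b)) refl

  vanishing-profile : ∀ L {P f} → HasProfile L P f → (∀ t → 1 ℕ.≤ t → t ℕ.≤ length L → f t K.≈ K.0#) →
    P ≈I con (f 0) ⊗ prodP (map (λ v → one ⊝ x[ v ]) L)
  vanishing-profile []      P~ _ = trans P~ (sym (*-identityʳ _))
  vanishing-profile (v ∷ L) {P} {f} (P₀ , P₁ , P≈ , P₀~ , P₁~) f≈0 = begin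
    P
      ≈⟨ P≈ ⟩
    (one ⊝ x[ v ]) ⊗ P₀ ⊕ x[ v ] ⊗ P₁
      ≈⟨ +-cong (*-congˡ (vanishing-profile L P₀~ (λ t 1≤t t≤L → f≈0 t 1≤t (ℕ.m≤n⇒m≤1+n t≤L))))
                (*-congˡ (vanishing-profile L P₁~ (λ t 1≤t t≤L → f≈0 (suc t) (s≤s z≤n) (s≤s t≤L)))) ⟩
    (one ⊝ x[ v ]) ⊗ (con (f 0) ⊗ Z) ⊕ x[ v ] ⊗ (con (f 1) ⊗ Z)
      ≈⟨ +-congˡ (*-congˡ (*-congʳ (con-cong-≈I (f≈0 1 (s≤s z≤n) (s≤s z≤n))))) ⟩
    (one ⊝ x[ v ]) ⊗ (con (f 0) ⊗ Z) ⊕ x[ v ] ⊗ (con K.0# ⊗ Z)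
      ≈⟨ collect x[ v ] (con (f 0)) Z ⟩
    con (f 0) ⊗ ((one ⊝ x[ v ]) ⊗ Z) ∎
    where
    Z = prodP (map (λ v → one ⊝ x[ v ]) L)
    collect : ∀ y a z → (one ⊝ y) ⊗ (a ⊗ z) ⊕ y ⊗ (con K.0# ⊗ z) ≈I a ⊗ ((one ⊝ y) ⊗ z)
    collect = solve 3 (λ y a z → (κ (ℤ.+ 1) :- y) :* (a :* z) :+ y :* (κ (ℤ.+ 0) :* z) := a :* ((κ (ℤ.+ 1) :- y) :* z)) refl

module VizingGraph {c ℓ} (K : CommutativeRing c ℓ) (m n : ℕ) where

  open import Data.Nat using (suc)
  open import Data.Fin using (Fin; punchIn)
  open import Data.Fin.Properties using (punchInᵢ≢i)
  open import Data.List using (List; []; _∷_; map; concatMap; allFin; _++_)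
  open import Data.List.Properties using (map-++; map-∘; map-concatMap)
  open import Data.Product using (_,_)
  open import Relation.Binary.PropositionalEquality as ≡ using (_≡_)
  import Data.Integer as ℤ

  open Vizing K m n
  open Profiles K m n
  open CommutativeRing quotientRing using (refl; sym; trans; +-cong; *-cong; +-congˡ; *-congˡ; *-congʳ;
    +-assoc; zeroˡ; zeroʳ; +-identityʳ; *-identityˡ; setoid; +-commutativeMonoid; *-commutativeMonoid; *-commutativeSemigroup)
  open import Algebra.Properties.CommutativeSemigroup *-commutativeSemigroup using () renaming (interchange to *-interchange)
  open IntegerCoefficients quotientRing using (solve; _:=_; _:+_; _:-_; _:*_; :-_) renaming (con to κ)
  open ListFolds +-commutativeMonoid using () renaming
    (fold-++ to sumP-++; fold-concatMap to sumP-concatMap; fold-map-cong to sumP-map-cong;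
     fold-map-∙ to sumP-map-⊕; fold-allFin-remove to sumP-allFin-remove)
  open ListFolds *-commutativeMonoid using () renaming (fold-++ to prodP-++; fold-allFin-remove to prodP-allFin-remove)
  open import Relation.Binary.Reasoning.Setoid setoid

  ≡⇒≈I : ∀ {p q} → p ≡ q → p ≈I q
  ≡⇒≈I ≡.refl = refl

  vertexSum-split : ∀ g h →
    sumP (concatMap (λ g′ → map (λ h′ → X g′ h′) (allFin (suc n))) (allFin (suc m)))
      ≈I sumP (map x[_] (T g h)) ⊕ sumP (map x[_] (notT g h))
  vertexSum-split g h = begin
    sumP (concatMap row (allFin (suc m)))
      ≈⟨ sumP-concatMap row (allFin (suc m)) ⟩
    sumP (map rowSum (allFin (suc m)))
      ≈⟨ sumP-allFin-remove rowSum g ⟩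
    rowSum g ⊕ sumP (map (λ i → rowSum (punchIn g i)) (allFin m))
      ≈⟨ +-congˡ (sumP-map-cong (allFin m) (λ i → sumP-allFin-remove (X (punchIn g i)) h)) ⟩
    rowSum g ⊕ sumP (map (λ i → X (punchIn g i) h ⊕ offRowSum i) (allFin m))
      ≈⟨ +-congˡ (sumP-map-⊕ (λ i → X (punchIn g i) h) offRowSum (allFin m)) ⟩
    rowSum g ⊕ (sumP (map (λ i → X (punchIn g i) h) (allFin m)) ⊕ sumP (map offRowSum (allFin m)))
      ≈⟨ +-assoc _ _ _ ⟨
    (rowSum g ⊕ sumP (map (λ i → X (punchIn g i) h) (allFin m))) ⊕ sumP (map offRowSum (allFin m))
      ≈⟨ +-cong onT offT ⟨
    sumP (map x[_] (T g h)) ⊕ sumP (map x[_] (notT g h)) ∎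
    where
    row : VG → List Poly
    row g′ = map (λ h′ → X g′ h′) (allFin (suc n))
    rowSum : VG → Poly
    rowSum g′ = sumP (row g′)
    offRowSum : Fin m → Poly
    offRowSum i = sumP (map (λ j → X (punchIn g i) (punchIn h j)) (allFin n))
    onT : sumP (map x[_] (T g h)) ≈I rowSum g ⊕ sumP (map (λ i → X (punchIn g i) h) (allFin m))
    onT = begin
      sumP (map x[_] (A ++ B))                     ≡⟨ ≡.cong sumP (map-++ x[_] A B) ⟩
      sumP (map x[_] A ++ map x[_] B)              ≈⟨ sumP-++ (map x[_] A) (map x[_] B) ⟩
      sumP (map x[_] A) ⊕ sumP (map x[_] B)        ≡⟨ ≡.cong₂ (λ a b → sumP a ⊕ sumP b) (map-∘ (allFin (suc n))) (map-∘ (allFin m)) ⟨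
      rowSum g ⊕ sumP (map (λ i → X (punchIn g i) h) (allFin m)) ∎
      where
      A = map (λ h′ → (g , h′)) (allFin (suc n))
      B = map (λ i → (punchIn g i , h)) (allFin m)
    offT : sumP (map x[_] (notT g h)) ≈I sumP (map offRowSum (allFin m))
    offT = begin
      sumP (map x[_] (concatMap G (allFin m)))                 ≡⟨ ≡.cong sumP (map-concatMap x[_] G (allFin m)) ⟩
      sumP (concatMap (λ i → map x[_] (G i)) (allFin m))       ≈⟨ sumP-concatMap (λ i → map x[_] (G i)) (allFin m) ⟩
      sumP (map (λ i → sumP (map x[_] (G i))) (allFin m))      ≈⟨ sumP-map-cong (allFin m) (λ i → ≡⇒≈I (≡.cong sumP (map-∘ (allFin n)))) ⟨
      sumP (map offRowSum (allFin m))                          ∎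
      where
      G = λ i → map (λ j → (punchIn g i , punchIn h j)) (allFin n)

  edgeFactor-absorbed : ∀ e v → (one ⊝ e ⊗ x[ v ]) ⊗ (one ⊝ x[ v ]) ≈I one ⊝ x[ v ]
  edgeFactor-absorbed e v = begin
    (one ⊝ e ⊗ x[ v ]) ⊗ (one ⊝ x[ v ])              ≈⟨ expand e x[ v ] ⟩
    (one ⊝ x[ v ]) ⊕ e ⊗ (x[ v ] ⊗ x[ v ] ⊝ x[ v ])  ≈⟨ +-congˡ (*-congˡ (x²-x≈0 v)) ⟩
    (one ⊝ x[ v ]) ⊕ e ⊗ con K.0#                   ≈⟨ trans (+-congˡ (zeroʳ e)) (+-identityʳ _) ⟩
    one ⊝ x[ v ]                                    ∎
    where
    expand : ∀ e y → (one ⊝ e ⊗ y) ⊗ (one ⊝ y) ≈I (one ⊝ y) ⊕ e ⊗ (y ⊗ y ⊝ y)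
    expand = solve 2 (λ e y → (κ (ℤ.+ 1) :- (e :* y)) :* (κ (ℤ.+ 1) :- y) := (κ (ℤ.+ 1) :- y) :+ e :* (y :* y :+ :- y)) refl

  edgeFactors-absorbed : ∀ {a} {A : Set a} (e : A → Poly) (w : A → Vertex) xs →
    prodP (map (λ i → one ⊝ e i ⊗ x[ w i ]) xs) ⊗ prodP (map (λ i → one ⊝ x[ w i ]) xs)
      ≈I prodP (map (λ i → one ⊝ x[ w i ]) xs)
  edgeFactors-absorbed e w []       = *-identityˡ _
  edgeFactors-absorbed e w (i ∷ xs) =
    trans (*-interchange _ _ _ _) (*-cong (edgeFactor-absorbed (e i) (w i)) (edgeFactors-absorbed e w xs))

  -- The domination generator x-dom g h divides the product, as (1 - e x)(1 - x) ≡ 1 - x.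
  vertexFactors∈ideal : ∀ g h → prodP (map (λ v → one ⊝ x[ v ]) (T g h)) ≈I con K.0#
  vertexFactors∈ideal g h = begin
    prodP (map (λ v → one ⊝ x[ v ]) (A ++ B))
      ≈⟨ trans (≡⇒≈I (≡.cong prodP (map-++ (λ v → one ⊝ x[ v ]) A B))) (prodP-++ (map (λ v → one ⊝ x[ v ]) A) _) ⟩
    prodP (map (λ v → one ⊝ x[ v ]) A) ⊗ prodP (map (λ v → one ⊝ x[ v ]) B)
      ≈⟨ *-cong (trans (≡⇒≈I (≡.cong prodP (≡.sym (map-∘ (allFin (suc n)))))) (prodP-allFin-remove (λ h′ → one ⊝ X g h′) h))
                (≡⇒≈I (≡.cong prodP (≡.sym (map-∘ (allFin m))))) ⟩
    ((one ⊝ X g h) ⊗ ΠH) ⊗ ΠG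
      ≈⟨ *-cong (*-congˡ (edgeFactors-absorbed edgesH (λ j → (g , punchIn h j)) (allFin n)))
                (edgeFactors-absorbed edgesG (λ i → (punchIn g i , h)) (allFin m)) ⟨
    ((one ⊝ X g h) ⊗ (AH ⊗ ΠH)) ⊗ (AG ⊗ ΠG)
      ≈⟨ regroup (one ⊝ X g h) AG ΠG AH ΠH ⟩
    ((one ⊝ X g h) ⊗ AG ⊗ AH) ⊗ (ΠG ⊗ ΠH)
      ≈⟨ *-congʳ (gen⇒≈I0 (x-dom g h)) ⟩
    con K.0# ⊗ (ΠG ⊗ ΠH)
      ≈⟨ zeroˡ _ ⟩
    con K.0# ∎
    where
    A = map (λ h′ → (g , h′)) (allFin (suc n))
    B = map (λ i → (punchIn g i , h)) (allFin m)
    ΠG = prodP (map (λ i → one ⊝ X (punchIn g i) h) (allFin m))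
    ΠH = prodP (map (λ j → one ⊝ X g (punchIn h j)) (allFin n))
    edgesG : Fin m → Poly
    edgesG i = var (edgeG g (punchIn g i) (λ eq → punchInᵢ≢i g i (≡.sym eq)))
    edgesH : Fin n → Poly
    edgesH j = var (edgeH h (punchIn h j) (λ eq → punchInᵢ≢i h j (≡.sym eq)))
    AG = prodP (map (λ i → one ⊝ edgesG i ⊗ X (punchIn g i) h) (allFin m))
    AH = prodP (map (λ j → one ⊝ edgesH j ⊗ X g (punchIn h j)) (allFin n))
    regroup : ∀ a b c d e → (a ⊗ (d ⊗ e)) ⊗ (b ⊗ c) ≈I (a ⊗ b ⊗ d) ⊗ (c ⊗ e)
    regroup = solve 5 (λ a b c d e → (a :* (d :* e)) :* (b :* c) := (a :* b :* d) :* (c :* e)) refl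

module CertificateReduction {c ℓ} (K : CommutativeRing c ℓ) (m n : ℕ)
  (cc : ℕ → ℕ → CommutativeRing.Carrier K) (g : Vizing.VG K m n) (h : Vizing.VH K m n) where

  open Binomial using (pascal)

  open import Data.Nat as ℕ using (suc)
  import Data.Nat.Properties as ℕ
  open import Data.List using (map; length; allFin; concatMap)
  open import Data.Fin using (Fin; punchIn)
  open import Data.Product using (_,_)
  open import Data.List.Properties using (length-++; length-map; length-tabulate)
  open import Relation.Binary.PropositionalEquality as ≡ using (_≡_)
  import Data.Integer as ℤ

  open Vizing K m n
  open Profiles K m n
  open VizingGraph K m n using (vertexSum-split)
  open CertificateValues K m n cc using (sValue; sValue-squares)
  open CommutativeRing quotientRing using (refl; +-cong; -‿cong; setoid; +-commutativeMonoid)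
  open ListFolds +-commutativeMonoid using () renaming (fold-map-cong to sumP-map-cong)
  open IntegerCoefficients quotientRing using (solve; _:=_; _:+_; _:-_) renaming (con to κ)
  open import Relation.Binary.Reasoning.Setoid setoid

  squaresSum : Poly
  squaresSum = sumP (map (λ w → s cc g h w ⊗ s cc g h w) (range 1 D))

  reduced : Poly
  reduced = (sumP (map x[_] (T g h)) ⊝ one) ⊝ squaresSum

  -- The squares x² of the vertices outside T_gh cancel against their linear terms in f_viz.
  certificate-reduced : fviz ⊝ certificate cc g h ≈I reduced
  certificate-reduced = begin
    (allX ⊝ con (natK 1)) ⊝ (sumP (map (λ v → x[ v ] ⊗ x[ v ]) (notT g h)) ⊕ squaresSum)
      ≈⟨ +-cong (+-cong (vertexSum-split g h) (-‿cong (con-cong-≈I (K.+-identityʳ K.1#))))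
                (-‿cong (+-cong (sumP-map-cong (notT g h) x²≈x) refl)) ⟩
    ((onT ⊕ offT) ⊝ one) ⊝ (offT ⊕ squaresSum)
      ≈⟨ solve 3 (λ a b c → ((a :+ b) :- κ (ℤ.+ 1)) :- (b :+ c) := (a :- κ (ℤ.+ 1)) :- c) refl onT offT squaresSum ⟩
    reduced ∎
    where
    allX = sumP (concatMap (λ g′ → map (λ h′ → X g′ h′) (allFin (suc n))) (allFin (suc m)))
    onT = sumP (map x[_] (T g h))
    offT = sumP (map x[_] (notT g h))

  s-profile : ∀ w → HasProfile (T g h) (s cc g h w) (λ t → sValue t w)
  s-profile w = sumP-profile (T g h) (range 0 D) (λ i → con (cc w i) ⊗ ρ i g h) (λ i t → cc w i K.* natK (pascal t i))
                  (λ i → ⊗-profile (T g h) (con-profile (T g h) (cc w i)) (elementary-profile (T g h) i))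

  reducedProfile : ℕ → K.Carrier
  reducedProfile t = (natK t K.- K.1#) K.- sumW (λ w → sValue t w K.* sValue t w)

  reduced-profile : HasProfile (T g h) reduced reducedProfile
  reduced-profile =
    ⊕-profile L (⊕-profile L (sumX-profile L) (⊖-profile L (con-profile L K.1#)))
      (⊖-profile L (sumP-profile L (range 1 D) (λ w → s cc g h w ⊗ s cc g h w) (λ w t → sValue t w K.* sValue t w)
                                 (λ w → ⊗-profile L (s-profile w) (s-profile w))))
    where L = T g h

  length-T : length (T g h) ≡ d
  length-T = ≡.trans (length-++ (map (λ h′ → (g , h′)) (allFin (suc n))))
                     (≡.trans (≡.cong₂ ℕ._+_ (length-map-allFin (λ h′ → (g , h′)))
                                              (length-map-allFin (λ i → (punchIn g i , h))))
                              (ℕ.+-comm (suc n) m))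
    where
    length-map-allFin : ∀ {k} {B : Set} (f : Fin k → B) → length (map f (allFin k)) ≡ k
    length-map-allFin {k} f = ≡.trans (length-map f (allFin k)) (length-tabulate (λ i → i))

  reducedProfile-vanishes : Hyp cc → ∀ t → 1 ℕ.≤ t → t ℕ.≤ length (T g h) → reducedProfile t K.≈ K.0#
  reducedProfile-vanishes hyp t 1≤t t≤|T| =
    K.trans (K.+-congˡ (K.-‿cong (sValue-squares hyp t 1≤t (≡.subst (t ℕ.≤_) length-T t≤|T|)))) (K.-‿inverseʳ _)

theorem5p1 : {c ℓ : Level} (K : CommutativeRing c ℓ) → FieldNotions.IsCharZeroField K →
    (m n : ℕ) → (cc : ℕ → ℕ → CommutativeRing.Carrier K) → Vizing.Hyp K m n cc →
    ∀ g h → Vizing.InIdeal K m n (Vizing.VizGen K m n)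
      (Vizing._⊝_ K m n (Vizing.fviz K m n) (Vizing.certificate K m n cc g h))
theorem5p1 K _ m n cc hyp g h = ≈I0⇒∈ideal (begin
  fviz ⊝ certificate cc g h
    ≈⟨ certificate-reduced ⟩
  reduced
    ≈⟨ vanishing-profile (T g h) reduced-profile (reducedProfile-vanishes hyp) ⟩
  con (reducedProfile 0) ⊗ prodP (map (λ v → one ⊝ x[ v ]) (T g h))
    ≈⟨ *-congˡ (vertexFactors∈ideal g h) ⟩
  con (reducedProfile 0) ⊗ con K.0#
    ≈⟨ zeroʳ _ ⟩
  con K.0# ∎)
  where
  open Vizing K m n
  open Profiles K m n
  open VizingGraph K m n using (vertexFactors∈ideal)
  open CertificateReduction K m n cc g h
  open CommutativeRing quotientRing using (*-congˡ; zeroʳ; setoid)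
  open import Relation.Binary.Reasoning.Setoid setoid
  open import Data.List using (map)
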